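{- Let $M=(H,\sigma,\alpha)$ be a rooted combinatorial map whose underlying graph $G$ has at least one edge, and let $F$ be a spanning forest of $G$ (an acyclic spanning subgraph, identified with its edge set). Then the procedure $\tau$ described below, run with input $F$, terminates, and its output $\tau(F)$ is a spanning tree of $G$.
   Context: A combinatorial map $M=(H,\sigma,\alpha)$ consists of a finite set $H$ of half-edges, a permutation $\sigma$ of $H$ and a fixed-point-free involution $\alpha$ of $H$ such that the group generated by $\sigma,\alpha$ acts transitively on $H$; it is rooted when a half-edge (the root) is distinguished. Its underlying graph has one vertex per cycle of $\sigma$ and one edge per cycle $\{h,\alpha(h)\}$ of $\alpha$, a vertex being incident to an edge when the corresponding cycles intersect; edges are identified with pairs of half-edges. An isthmus is an edge whose deletion increases the number of connected components. If $e=\{h_1,h_2\}$ is not an isthmus, the map $M\setminus e$ is $(H\setminus\{h_1,h_2\},\sigma_d,\alpha|_{H\setminus\{h_1,h_2\}})$ where $\sigma_d(h)$ is the first element of $\sigma(h),\sigma^2(h),\sigma^3(h)$ not lying in $\{h_1,h_2\}$ (i.e. $h_1,h_2$ are removed from the cyclic orders around vertices). The procedure $\tau$ on input $F$: set $h:=$ root of $M$ and $M':=M$; while some edge of $G$ has not yet been visited, do: let $e$ be the edge containing $h$ (this edge is now visited); replace $h$ by $\sigma'(\alpha(h))$, where $\sigma'$ is the permutation of the current map $M'$; if $e$ is not an isthmus of (the underlying graph of) $M'$ and $e\notin F$, replace $M'$ by $M'\setminus e$. The output $\tau(F)$ is the edge set of the final $M'$. -}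

module Defs where

open import Data.Nat using (ℕ; zero; suc)
open import Data.Fin using (Fin; zero; suc; inject₁; fromℕ; _≟_)
open import Data.Fin.Permutation using (Permutation′; _⟨$⟩ʳ_; _⟨$⟩ˡ_)
open import Data.Bool using (Bool; true; false; _∧_; _∨_; not; if_then_else_)
open import Data.Product using (Σ; ∃; _×_; _,_)
open import Data.Sum using (_⊎_)
open import Relation.Nullary using (¬_)
open import Relation.Nullary.Decidable using (⌊_⌋)
open import Relation.Binary.PropositionalEquality using (_≡_; _≢_)
open import Relation.Binary.Construct.Closure.ReflexiveTransitive using (Star)

iter : ∀ {n} → (Fin n → Fin n) → ℕ → Fin n → Fin n
iter f zero    x = x
iter f (suc k) x = f (iter f k x)

data Orbit {n} (σ : Permutation′ n) (α : Fin n → Fin n) : Fin n → Fin n → Set where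
  here  : ∀ {x} → Orbit σ α x x
  stepσ  : ∀ {x y} → Orbit σ α x y → Orbit σ α x (σ ⟨$⟩ʳ y)
  stepσ⁻ : ∀ {x y} → Orbit σ α x y → Orbit σ α x (σ ⟨$⟩ˡ y)
  stepα  : ∀ {x y} → Orbit σ α x y → Orbit σ α x (α y)

record IsMap {n} (σ : Permutation′ n) (α : Fin n → Fin n) : Set where
  field
    α-invol      : ∀ h → α (α h) ≡ h
    α-fixfree    : ∀ h → α h ≢ h
    transitive   : ∀ h h′ → Orbit σ α h h′

-- two half-edges lie at the same vertex (same cycle of the permutation f)
SameVertex : ∀ {n} → (Fin n → Fin n) → Fin n → Fin n → Set
SameVertex f x y = ∃ λ k → iter f k x ≡ y

-- Edge sets are represented by Bool-valued predicates on half-edges,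
-- closed under α (an edge {h, α h} is in the set iff h is).
EdgeSet : ℕ → Set
EdgeSet n = Fin n → Bool

ClosedUnderα : ∀ {n} → (Fin n → Fin n) → EdgeSet n → Set
ClosedUnderα α T = ∀ h → T (α h) ≡ T h

data ConnT {n} (σ : Permutation′ n) (α : Fin n → Fin n) (T : EdgeSet n)
     : Fin n → Fin n → Set where
  vtx   : ∀ {x y} → SameVertex (σ ⟨$⟩ʳ_) x y → ConnT σ α T x y
  edge  : ∀ {x} → T x ≡ true → ConnT σ α T x (α x)
  sym′  : ∀ {x y} → ConnT σ α T x y → ConnT σ α T y x
  trans′ : ∀ {x y z} → ConnT σ α T x y → ConnT σ α T y z → ConnT σ α T x z

-- (V(G), T) is connected (every vertex carries a half-edge)
Connected : ∀ {n} → Permutation′ n → (Fin n → Fin n) → EdgeSet n → Set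
Connected σ α T = ∀ x y → ConnT σ α T x y

-- A cycle of length m+1 in (V(G), T): half-edges w 0, …, w m, the i-th
-- edge {w i, α (w i)} going from the vertex of w i to the vertex of
-- α (w i), which is the vertex of w (i+1) (cyclically); edges pairwise
-- distinct and vertices pairwise distinct.  (m = 0 gives loops.)
record Cycle {n} (σ : Permutation′ n) (α : Fin n → Fin n) (T : EdgeSet n) : Set where
  field
    m         : ℕ
    w         : Fin (suc m) → Fin n
    inT       : ∀ i → T (w i) ≡ true
    consec    : ∀ (i : Fin m) → SameVertex (σ ⟨$⟩ʳ_) (α (w (inject₁ i))) (w (suc i))
    closing   : SameVertex (σ ⟨$⟩ʳ_) (α (w (fromℕ m))) (w zero)
    edgesDist : ∀ i j → i ≢ j → (w i ≢ w j) × (w i ≢ α (w j))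
    vertsDist : ∀ i j → i ≢ j → ¬ SameVertex (σ ⟨$⟩ʳ_) (w i) (w j)

Acyclic : ∀ {n} → Permutation′ n → (Fin n → Fin n) → EdgeSet n → Set
Acyclic σ α T = ¬ Cycle σ α T

SpanningForest : ∀ {n} → Permutation′ n → (Fin n → Fin n) → EdgeSet n → Set
SpanningForest σ α F = ClosedUnderα α F × Acyclic σ α F

SpanningTree : ∀ {n} → Permutation′ n → (Fin n → Fin n) → EdgeSet n → Set
SpanningTree σ α T = ClosedUnderα α T × Connected σ α T × Acyclic σ α T

-- Current map M′ during the procedure: set S of remaining half-edges
-- and its vertex permutation σ′ (only meaningful on S).

_∈e_ : ∀ {n} → Fin n → (Fin n × Fin n) → Bool
x ∈e (h₁ , h₂) = ⌊ x ≟ h₁ ⌋ ∨ ⌊ x ≟ h₂ ⌋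

deleteσ : ∀ {n} → (Fin n → Fin n) → Fin n → Fin n → Fin n → Fin n
deleteσ σ′ h₁ h₂ x =
  if not (σ′ x ∈e (h₁ , h₂)) then σ′ x
  else if not (σ′ (σ′ x) ∈e (h₁ , h₂)) then σ′ (σ′ x)
  else σ′ (σ′ (σ′ x))

removeE : ∀ {n} → EdgeSet n → Fin n → Fin n → EdgeSet n
removeE S h₁ h₂ x = S x ∧ not (x ∈e (h₁ , h₂))

-- connectivity in the underlying graph of M′ with the edge {h, α h} deleted
-- (graph deletion: vertices are kept)
data ConnDel {n} (S : EdgeSet n) (σ′ : Fin n → Fin n) (α : Fin n → Fin n) (h : Fin n)
     : Fin n → Fin n → Set where
  vtx    : ∀ {x y} → SameVertex σ′ x y → ConnDel S σ′ α h x y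
  edge   : ∀ {x} → S x ≡ true → x ≢ h → x ≢ α h → ConnDel S σ′ α h x (α x)
  sym′   : ∀ {x y} → ConnDel S σ′ α h x y → ConnDel S σ′ α h y x
  trans′ : ∀ {x y z} → ConnDel S σ′ α h x y → ConnDel S σ′ α h y z → ConnDel S σ′ α h x z

Isthmus : ∀ {n} → EdgeSet n → (Fin n → Fin n) → (Fin n → Fin n) → Fin n → Set
Isthmus S σ′ α h = S h ≡ true × ¬ ConnDel S σ′ α h h (α h)

-- The procedure τ as a (deterministic) transition system.

record State (n : ℕ) : Set where
  constructor st
  field
    cur     : Fin n
    sub     : EdgeSet n          -- half-edges of M′
    perm    : Fin n → Fin n
    visited : EdgeSet n          -- visited edges (as half-edge set)

mark : ∀ {n} → EdgeSet n → Fin n → Fin n → EdgeSet n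
mark V h₁ h₂ x = V x ∨ (x ∈e (h₁ , h₂))

SomeUnvisited : ∀ {n} → State n → Set
SomeUnvisited s = ∃ λ x → State.visited s x ≡ false

AllVisited : ∀ {n} → State n → Set
AllVisited s = ∀ x → State.visited s x ≡ true

data Step {n} (α : Fin n → Fin n) (F : EdgeSet n) : State n → State n → Set where
  delete : ∀ {h S σ′ V} → SomeUnvisited (st h S σ′ V)
         → ¬ Isthmus S σ′ α h → F h ≡ false
         → Step α F (st h S σ′ V)
                    (st (σ′ (α h)) (removeE S h (α h)) (deleteσ σ′ h (α h)) (mark V h (α h)))
  keep   : ∀ {h S σ′ V} → SomeUnvisited (st h S σ′ V)
         → Isthmus S σ′ α h ⊎ F h ≡ true
         → Step α F (st h S σ′ V)
                    (st (σ′ (α h)) S σ′ (mark V h (α h)))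

initState : ∀ {n} → Permutation′ n → Fin n → State n
initState σ root = st root (λ _ → true) (σ ⟨$⟩ʳ_) (λ _ → false)

Run : ∀ {n} → (Fin n → Fin n) → EdgeSet n → State n → State n → Set
Run α F = Star (Step α F)

module Submission where

-- Procedure.Invariant says that the
-- current map M′ = (S, σ′) is connected and obtained from M by deletions,
-- that deleted edges are visited and outside F, and that visited live edges
-- outside F are isthmuses of M′; steps preserve it (keep-preserves,
-- DeleteStep.preserved).  Once all is visited, an edge outside F on a cycle
-- of M′ would be bypassed by the cycle (CycleBypass), so M′ is a spanning
-- tree (final-tree).  The measure #live + #unvisited decreases along runs:
-- from a live half-edge τ follows its face, and a face of visited kept edges
-- with something unvisited is impossible, as it would either cover the map
-- or its one-sided edges would form a cycle of F (FaceWalk, WalkCycle).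

open import Defs
open import Data.Nat using (ℕ; zero; suc; _+_; _*_; _∸_; _≤_; _<_; z≤n; s≤s; _≤?_; _≟_; NonZero)
open import Data.Nat.Properties
open import Data.Nat.DivMod using (_%_; _/_; m≡m%n+[m/n]*n; m%n<n)
open import Data.Nat.Induction using (<-wellFounded)
open import Induction.WellFounded using (Acc; acc)
open import Data.Fin using (Fin; zero; suc; toℕ; fromℕ<; inject₁; fromℕ) renaming (_≟_ to _≟F_)
open import Data.Fin.Properties using (pigeonhole; toℕ<n; toℕ-fromℕ<; toℕ-fromℕ; toℕ-inject₁; toℕ-injective; any?; all?; ¬∀⟶∃¬)
open import Data.Fin.Permutation using (Permutation′; _⟨$⟩ʳ_; _⟨$⟩ˡ_; inverseˡ; inverseʳ)
open import Data.Bool using (Bool; true; false; _∧_; _∨_; not; if_then_else_)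
open import Data.Bool.Properties using (∨-comm; ¬-not) renaming (_≟_ to _≟B_)
open import Data.Product using (Σ; ∃; _×_; _,_; proj₁; proj₂)
open import Data.Sum using (_⊎_; inj₁; inj₂; [_,_]′)
open import Data.Unit using (⊤; tt)
open import Data.Empty using (⊥; ⊥-elim)
open import Relation.Nullary using (¬_; Dec; yes; no; ¬?; _→-dec_)
open import Relation.Nullary.Decidable using (⌊_⌋; decidable-stable)
open import Relation.Binary.PropositionalEquality
open import Relation.Binary.Definitions using (tri<; tri≈; tri>)
open import Relation.Binary.Construct.Closure.ReflexiveTransitive using (Star; ε; _◅_; _◅◅_; reverse)

module Iteration {n : ℕ} where

  iter-+ : ∀ (f : Fin n → Fin n) a b x → iter f (a + b) x ≡ iter f a (iter f b x)
  iter-+ f zero    b x = refl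
  iter-+ f (suc a) b x = cong f (iter-+ f a b x)

  iter-suc : ∀ (f : Fin n → Fin n) k x → iter f (suc k) x ≡ iter f k (f x)
  iter-suc f k x = trans (cong (λ m → iter f m x) (+-comm 1 k)) (iter-+ f k 1 x)

  iter-preserves : ∀ (P : Fin n → Set) (f : Fin n → Fin n) → (∀ x → P x → P (f x))
                 → ∀ k x → P x → P (iter f k x)
  iter-preserves P f closed zero    x px = px
  iter-preserves P f closed (suc k) x px = closed _ (iter-preserves P f closed k x px)

  iter-periodic : ∀ (f : Fin n → Fin n) p x → iter f p x ≡ x → ∀ q → iter f (q * p) x ≡ x
  iter-periodic f p x per zero    = refl
  iter-periodic f p x per (suc q) = begin
    iter f (p + q * p) x     ≡⟨ iter-+ f p (q * p) x ⟩
    iter f p (iter f (q * p) x) ≡⟨ cong (iter f p) (iter-periodic f p x per q) ⟩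
    iter f p x               ≡⟨ per ⟩
    x                        ∎
    where open ≡-Reasoning

  sv-trans : ∀ (f : Fin n → Fin n) {x y z} → SameVertex f x y → SameVertex f y z → SameVertex f x z
  sv-trans f {x} (a , refl) (b , refl) = b + a , iter-+ f b a x

  -- Orbits of a map f that is injective on an f-closed set P: every orbit
  -- starting in P is a cycle, so "same orbit" is symmetric and decidable.
  module InjectiveOn (P : Fin n → Set) (f : Fin n → Fin n)
                     (closed : ∀ x → P x → P (f x))
                     (inj : ∀ x y → P x → P y → f x ≡ f y → x ≡ y) where

    iter-cancel : ∀ a {x y} → P x → P y → iter f a x ≡ iter f a y → x ≡ y
    iter-cancel zero    px py e = e
    iter-cancel (suc a) px py e = iter-cancel a px py
      (inj _ _ (iter-preserves P f closed a _ px) (iter-preserves P f closed a _ py) e)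

    -- by the pigeonhole principle some f^(suc d) fixes x
    period : ∀ x → P x → ∃ λ d → iter f (suc d) x ≡ x
    period x px with pigeonhole (n<1+n n) (λ (i : Fin (suc n)) → iter f (toℕ i) x)
    ... | i , j , i<j , eq with m≤n⇒∃[o]m+o≡n i<j
    ... | d , i+1+d≡j = d , sym (iter-cancel (toℕ i) px (iter-preserves P f closed (suc d) x px) (begin
      iter f (toℕ i) x                 ≡⟨ eq ⟩
      iter f (toℕ j) x                 ≡⟨ cong (λ m → iter f m x) (sym (trans (+-suc (toℕ i) d) i+1+d≡j)) ⟩
      iter f (toℕ i + suc d) x         ≡⟨ iter-+ f (toℕ i) (suc d) x ⟩
      iter f (toℕ i) (iter f (suc d) x) ∎))
      where open ≡-Reasoning

    iter-mod : ∀ x p .{{_ : NonZero p}} → iter f p x ≡ x → ∀ k → iter f (k % p) x ≡ iter f k x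
    iter-mod x p per k = begin
      iter f (k % p) x                       ≡⟨ cong (iter f (k % p)) (sym (iter-periodic f p x per (k / p))) ⟩
      iter f (k % p) (iter f (k / p * p) x)  ≡⟨ sym (iter-+ f (k % p) (k / p * p) x) ⟩
      iter f (k % p + k / p * p) x           ≡⟨ cong (λ m → iter f m x) (sym (m≡m%n+[m/n]*n k p)) ⟩
      iter f k x                             ∎
      where open ≡-Reasoning

    sv-sym : ∀ {x y} → P x → SameVertex f x y → SameVertex f y x
    sv-sym {x} px (k , refl) with period x px
    ... | d , per with m≤n⇒∃[o]m+o≡n (<⇒≤ (m%n<n k (suc d)))
    ... | e , r+e≡p = e , (begin
      iter f e (iter f k x)          ≡⟨ cong (iter f e) (sym (iter-mod x (suc d) per k)) ⟩
      iter f e (iter f (k % suc d) x) ≡⟨ sym (iter-+ f e (k % suc d) x) ⟩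
      iter f (e + k % suc d) x       ≡⟨ cong (λ m → iter f m x) (trans (+-comm e _) r+e≡p) ⟩
      iter f (suc d) x               ≡⟨ per ⟩
      x                              ∎)
      where open ≡-Reasoning

    decSV : ∀ {x} y → P x → Dec (SameVertex f x y)
    decSV {x} y px with period x px
    ... | d , per with any? (λ (k : Fin (suc d)) → iter f (toℕ k) x ≟F y)
    ... | yes (k , e) = yes (toℕ k , e)
    ... | no none = no λ { (k , refl) → none (fromℕ< (m%n<n k (suc d)) ,
            trans (cong (λ m → iter f m x) (toℕ-fromℕ< (m%n<n k (suc d)))) (iter-mod x (suc d) per k)) }

least-below : (P : ℕ → Set) → (∀ k → Dec (P k)) → ∀ N
            → (Σ ℕ λ k → k < N × P k × (∀ j → j < k → ¬ P j)) ⊎ (∀ k → k < N → ¬ P k)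
least-below P P? zero = inj₂ (λ k ())
least-below P P? (suc N) with least-below P P? N
... | inj₁ (k , k<N , pk , below) = inj₁ (k , m<n⇒m<1+n k<N , pk , below)
... | inj₂ none with P? N
...   | yes pN = inj₁ (N , ≤-refl , pN , none)
...   | no ¬pN = inj₂ λ k k<1+N → [ none k , (λ { refl → ¬pN }) ]′ (m≤n⇒m<n∨m≡n (≤-pred k<1+N))

module BoolFacts where

  bool-cases : ∀ (b : Bool) → b ≡ true ⊎ b ≡ false
  bool-cases true  = inj₁ refl
  bool-cases false = inj₂ refl

  true≢false : ∀ {b} → b ≡ true → b ≡ false → ⊥
  true≢false refl ()

  bool-ext : ∀ {a b : Bool} → (a ≡ true → b ≡ true) → (b ≡ true → a ≡ true) → a ≡ b
  bool-ext {false} {false} f g = refl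
  bool-ext {false} {true}  f g = g refl
  bool-ext {true}  {false} f g = sym (f refl)
  bool-ext {true}  {true}  f g = refl

  ∨-introˡ : ∀ {a} b → a ≡ true → a ∨ b ≡ true
  ∨-introˡ b refl = refl

  ∨-introʳ : ∀ a {b} → b ≡ true → a ∨ b ≡ true
  ∨-introʳ true  e = refl
  ∨-introʳ false e = e

  ∨-elim : ∀ a {b} → a ∨ b ≡ true → a ≡ true ⊎ b ≡ true
  ∨-elim true  e = inj₁ refl
  ∨-elim false e = inj₂ e

  ∧-intro : ∀ {a b} → a ≡ true → b ≡ true → a ∧ b ≡ true
  ∧-intro refl refl = refl

  ∧-elimˡ : ∀ a {b} → a ∧ b ≡ true → a ≡ true
  ∧-elimˡ true e = refl

  ∧-elimʳ : ∀ a {b} → a ∧ b ≡ true → b ≡ true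
  ∧-elimʳ true e = e

  not-intro : ∀ {a} → a ≡ false → not a ≡ true
  not-intro refl = refl

  not-elim : ∀ {a} → not a ≡ true → a ≡ false
  not-elim {false} e = refl

  witness : ∀ {A : Set} (a? : Dec A) → ⌊ a? ⌋ ≡ true → A
  witness (yes a) e = a

  decided-yes : ∀ {A : Set} (a? : Dec A) → A → ⌊ a? ⌋ ≡ true
  decided-yes (yes _) a = refl
  decided-yes (no ¬a) a = ⊥-elim (¬a a)

  decided-no : ∀ {A : Set} (a? : Dec A) → ¬ A → ⌊ a? ⌋ ≡ false
  decided-no (yes a) ¬a = ⊥-elim (¬a a)
  decided-no (no _)  ¬a = refl

open BoolFacts

module Counting where

  _⊆B_ : ∀ {n} → (Fin n → Bool) → (Fin n → Bool) → Set
  f ⊆B g = ∀ x → f x ≡ true → g x ≡ true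

  count : ∀ {n} → (Fin n → Bool) → ℕ
  count {zero}  f = 0
  count {suc n} f = (if f zero then 1 else 0) + count (λ i → f (suc i))

  count≤n : ∀ {n} (f : Fin n → Bool) → count f ≤ n
  count≤n {zero}  f = z≤n
  count≤n {suc n} f with f zero
  ... | true  = s≤s (count≤n (λ i → f (suc i)))
  ... | false = m≤n⇒m≤1+n (count≤n (λ i → f (suc i)))

  count-mono : ∀ {n} (f g : Fin n → Bool) → f ⊆B g → count f ≤ count g
  count-mono {zero}  f g f⊆g = z≤n
  count-mono {suc n} f g f⊆g with f zero in e1 | g zero in e2
  ... | true  | true  = s≤s (count-mono _ _ (λ x → f⊆g (suc x)))
  ... | false | true  = m≤n⇒m≤1+n (count-mono _ _ (λ x → f⊆g (suc x)))
  ... | false | false = count-mono _ _ (λ x → f⊆g (suc x))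
  ... | true  | false = ⊥-elim (true≢false (f⊆g zero e1) e2)

  count-strict : ∀ {n} (f g : Fin n → Bool) → f ⊆B g → ∀ z → f z ≡ false → g z ≡ true
               → count f < count g
  count-strict {suc n} f g f⊆g zero fz gz rewrite fz | gz = s≤s (count-mono _ _ (λ x → f⊆g (suc x)))
  count-strict {suc n} f g f⊆g (suc z) fz gz with f zero in e1 | g zero in e2
  ... | true  | true  = s≤s (count-strict _ _ (λ x → f⊆g (suc x)) z fz gz)
  ... | false | true  = m<n⇒m<1+n (count-strict _ _ (λ x → f⊆g (suc x)) z fz gz)
  ... | false | false = count-strict _ _ (λ x → f⊆g (suc x)) z fz gz
  ... | true  | false = ⊥-elim (true≢false (f⊆g zero e1) e2)

  count-pos : ∀ {n} (f : Fin n → Bool) z → f z ≡ true → 0 < count f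
  count-pos f zero    fz rewrite fz = s≤s z≤n
  count-pos f (suc z) fz with f zero
  ... | true  = s≤s z≤n
  ... | false = count-pos _ z fz

  count-ext : ∀ {n} (f g : Fin n → Bool) → (∀ x → f x ≡ g x) → count f ≡ count g
  count-ext f g f≗g = ≤-antisym (count-mono f g (λ x fx → trans (sym (f≗g x)) fx))
                                (count-mono g f (λ x gx → trans (f≗g x) gx))

open Counting

module Pair {n : ℕ} where

  ∈e-elim : ∀ (x a b : Fin n) → x ∈e (a , b) ≡ true → x ≡ a ⊎ x ≡ b
  ∈e-elim x a b e with x ≟F a | x ≟F b
  ... | yes p | _     = inj₁ p
  ... | no _  | yes q = inj₂ q

  ∈e-l : ∀ (a b : Fin n) → a ∈e (a , b) ≡ true
  ∈e-l a b = ∨-introˡ _ (decided-yes (a ≟F a) refl)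

  ∈e-r : ∀ (a b : Fin n) → b ∈e (a , b) ≡ true
  ∈e-r a b = ∨-introʳ ⌊ b ≟F a ⌋ (decided-yes (b ≟F b) refl)

  ∉e : ∀ {x a b : Fin n} → x ≢ a → x ≢ b → x ∈e (a , b) ≡ false
  ∉e {x} {a} {b} x≢a x≢b rewrite decided-no (x ≟F a) x≢a | decided-no (x ≟F b) x≢b = refl

  ∉e-elim : ∀ {x a b : Fin n} → x ∈e (a , b) ≡ false → x ≢ a × x ≢ b
  ∉e-elim {x} {a} {b} e = (λ { refl → true≢false (∈e-l x b) e }) , (λ { refl → true≢false (∈e-r a x) e })

  pair-pigeonhole : ∀ {a b x y z : Fin n} → x ∈e (a , b) ≡ true → y ∈e (a , b) ≡ true → z ∈e (a , b) ≡ true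
                  → x ≢ y → y ≢ z → x ≢ z → ⊥
  pair-pigeonhole {a} {b} {x} {y} {z} ex ey ez x≢y y≢z x≢z
    with ∈e-elim x a b ex | ∈e-elim y a b ey | ∈e-elim z a b ez
  ... | inj₁ p | inj₁ q | _      = x≢y (trans p (sym q))
  ... | inj₂ p | inj₂ q | _      = x≢y (trans p (sym q))
  ... | inj₁ p | inj₂ q | inj₁ r = x≢z (trans p (sym r))
  ... | inj₁ p | inj₂ q | inj₂ r = y≢z (trans q (sym r))
  ... | inj₂ p | inj₁ q | inj₁ r = y≢z (trans q (sym r))
  ... | inj₂ p | inj₁ q | inj₂ r = x≢z (trans p (sym r))

  removeE-elim : ∀ (S : EdgeSet n) a b x → removeE S a b x ≡ true → S x ≡ true × x ∈e (a , b) ≡ false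
  removeE-elim S a b x e = ∧-elimˡ (S x) e , not-elim (∧-elimʳ (S x) e)

  removeE-intro : ∀ (S : EdgeSet n) a b x → S x ≡ true → x ∈e (a , b) ≡ false → removeE S a b x ≡ true
  removeE-intro S a b x Sx x∉ rewrite Sx | x∉ = refl

  removeE-false : ∀ (S : EdgeSet n) a b x → removeE S a b x ≡ false → x ∈e (a , b) ≡ true ⊎ S x ≡ false
  removeE-false S a b x e with bool-cases (x ∈e (a , b)) | bool-cases (S x)
  ... | inj₁ x∈ | _      = inj₁ x∈
  ... | inj₂ x∉ | inj₂ Sx = inj₂ Sx
  ... | inj₂ x∉ | inj₁ Sx = ⊥-elim (true≢false (removeE-intro S a b x Sx x∉) e)

  mark-old : ∀ (V : EdgeSet n) a b x → V x ≡ true → mark V a b x ≡ true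
  mark-old V a b x Vx = ∨-introˡ _ Vx

  mark-new : ∀ (V : EdgeSet n) a b x → x ∈e (a , b) ≡ true → mark V a b x ≡ true
  mark-new V a b x x∈ = ∨-introʳ (V x) x∈

  mark-false : ∀ (V : EdgeSet n) a b x → V x ≡ false → x ∈e (a , b) ≡ false → mark V a b x ≡ false
  mark-false V a b x ¬Vx x∉ rewrite ¬Vx | x∉ = refl

  mark-unmarked : ∀ (V : EdgeSet n) a b x → mark V a b x ≡ true → x ∈e (a , b) ≡ false → V x ≡ true
  mark-unmarked V a b x e x∉ with ∨-elim (V x) e
  ... | inj₁ Vx = Vx
  ... | inj₂ x∈ = ⊥-elim (true≢false x∈ x∉)

open Pair

-- Starting from {x} and repeatedly adding E-neighbours, the sets grow
-- strictly until they stabilise, hence within n rounds, at an E-closed set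
-- all of whose points are reachable from x.
module Saturation {n : ℕ} (E : Fin n → Fin n → Bool) where

  Reach : Fin n → Fin n → Set
  Reach = Star (λ a b → E a b ≡ true)

  Closed : (Fin n → Bool) → Set
  Closed R = ∀ w z → R w ≡ true → E w z ≡ true → R z ≡ true

  closed-reach : ∀ {R} → Closed R → ∀ {a b} → Reach a b → R a ≡ true → R b ≡ true
  closed-reach cl ε          ra = ra
  closed-reach cl (e ◅ path) ra = closed-reach cl path (cl _ _ ra e)

  module _ (x : Fin n) where

    within : ℕ → Fin n → Bool
    within zero    z = ⌊ z ≟F x ⌋
    within (suc k) z = within k z ∨ ⌊ any? (λ w → (within k w ∧ E w z) ≟B true) ⌋

    within-sound : ∀ k z → within k z ≡ true → Reach x z
    within-sound zero z e with witness (z ≟F x) e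
    ... | refl = ε
    within-sound (suc k) z e with ∨-elim (within k z) e
    ... | inj₁ e′ = within-sound k z e′
    ... | inj₂ e′ with witness (any? _) e′
    ...   | w , wz = within-sound k w (∧-elimˡ (within k w) wz) ◅◅ (∧-elimʳ (within k w) wz ◅ ε)

    within-x : ∀ k → within k x ≡ true
    within-x zero    = decided-yes (x ≟F x) refl
    within-x (suc k) = ∨-introˡ _ (within-x k)

    within-mono : ∀ k → within k ⊆B within (suc k)
    within-mono k z e = ∨-introˡ _ e

    newly-added : ∀ k z → within (suc k) z ≢ within k z → within k z ≡ false × within (suc k) z ≡ true
    newly-added k z ne with bool-cases (within k z) | bool-cases (within (suc k) z)
    ... | inj₁ old | _        = ⊥-elim (ne (trans (within-mono k z old) (sym old)))
    ... | inj₂ old | inj₁ new = old , new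
    ... | inj₂ old | inj₂ new = ⊥-elim (ne (trans new (sym old)))

    grows : ∀ k → (∃ λ j → Closed (within j)) ⊎ k < count (within k)
    grows zero = inj₂ (count-pos (within 0) x (within-x 0))
    grows (suc k) with grows k
    ... | inj₁ closed = inj₁ closed
    ... | inj₂ big with all? (λ z → within (suc k) z ≟B within k z)
    ...   | yes stable = inj₁ (k , λ w z rw ewz →
              trans (sym (stable z)) (∨-introʳ (within k z) (decided-yes (any? _) (w , ∧-intro rw ewz))))
    ...   | no unstable with ¬∀⟶∃¬ n _ (λ z → within (suc k) z ≟B within k z) unstable
    ...     | z , new = inj₂ (≤-trans (s≤s big) (count-strict _ _ (within-mono k) z (proj₁ (newly-added k z new)) (proj₂ (newly-added k z new))))

    saturate : ∃ λ R → R x ≡ true × Closed R × (∀ z → R z ≡ true → Reach x z)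
    saturate with grows n
    ... | inj₁ (j , closed) = within j , within-x j , closed , within-sound j
    ... | inj₂ big = ⊥-elim (<⇒≱ big (count≤n _))

  decReach : ∀ x y → Dec (Reach x y)
  decReach x y with saturate x
  ... | R , Rx , closed , sound with R y in Ry
  ... | true  = yes (sound y Ry)
  ... | false = no λ path → true≢false (closed-reach closed path Rx) Ry

-- Being an isthmus is decidable: connectivity after deleting {h, α h}
-- coincides with reachability along the symmetric adjacency "one step of
-- σ′, or one surviving edge", which is decidable by saturation.
module DeletedConnectivity {n : ℕ} (S : EdgeSet n) (σ′ α : Fin n → Fin n) (h : Fin n) where

  survives : Fin n → Bool
  survives w = S w ∧ not (w ∈e (h , α h))

  step : Fin n → Fin n → Bool
  step w z = ⌊ σ′ w ≟F z ⌋ ∨ (survives w ∧ ⌊ α w ≟F z ⌋)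

  adjacent : Fin n → Fin n → Bool
  adjacent w z = step w z ∨ step z w

  open Saturation adjacent

  survives-sound : ∀ {w} → survives w ≡ true → S w ≡ true × w ≢ h × w ≢ α h
  survives-sound {w} e = ∧-elimˡ (S w) e , ∉e-elim (not-elim (∧-elimʳ (S w) e))

  step-sound : ∀ {w z} → step w z ≡ true → ConnDel S σ′ α h w z
  step-sound {w} e with ∨-elim ⌊ σ′ w ≟F _ ⌋ e
  ... | inj₁ e′ with refl ← witness (σ′ w ≟F _) e′ = vtx (1 , refl)
  ... | inj₂ e′ with refl ← witness (α w ≟F _) (∧-elimʳ (survives w) e′)
                   | Sw , w≢h , w≢αh ← survives-sound (∧-elimˡ (survives w) e′) = edge Sw w≢h w≢αh

  reach-sound : ∀ {a b} → Reach a b → ConnDel S σ′ α h a b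
  reach-sound ε = vtx (0 , refl)
  reach-sound {a} {b} (e ◅ path) with ∨-elim (step a _) e
  ... | inj₁ e′ = trans′ (step-sound e′) (reach-sound path)
  ... | inj₂ e′ = trans′ (sym′ (step-sound e′)) (reach-sound path)

  reach-reverse : ∀ {a b} → Reach a b → Reach b a
  reach-reverse = reverse λ {w} {z} e → trans (∨-comm (step z w) (step w z)) e

  σ′-adjacent : ∀ w → adjacent w (σ′ w) ≡ true
  σ′-adjacent w = ∨-introˡ _ (∨-introˡ _ (decided-yes (σ′ w ≟F σ′ w) refl))

  σ′-reach : ∀ k a → Reach a (iter σ′ k a)
  σ′-reach zero    a = ε
  σ′-reach (suc k) a = σ′-reach k a ◅◅ (σ′-adjacent (iter σ′ k a) ◅ ε)

  reach-complete : ∀ {a b} → ConnDel S σ′ α h a b → Reach a b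
  reach-complete (vtx (k , refl)) = σ′-reach k _
  reach-complete (edge {x} Sx x≢h x≢αh) =
    ∨-introˡ _ (∨-introʳ ⌊ σ′ x ≟F α x ⌋ (∧-intro (∧-intro Sx (not-intro (∉e x≢h x≢αh))) (decided-yes (_ ≟F _) refl))) ◅ ε
  reach-complete (sym′ c)     = reach-reverse (reach-complete c)
  reach-complete (trans′ c d) = reach-complete c ◅◅ reach-complete d

  decConnDel : ∀ a b → Dec (ConnDel S σ′ α h a b)
  decConnDel a b with decReach a b
  ... | yes path = yes (reach-sound path)
  ... | no ¬path = no (λ c → ¬path (reach-complete c))

  decIsthmus : Dec (Isthmus S σ′ α h)
  decIsthmus with S h ≟B true | decConnDel h (α h)
  ... | yes Sh | no ¬c = yes (Sh , ¬c)
  ... | yes Sh | yes c = no λ isthmus → proj₂ isthmus c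
  ... | no ¬Sh | _     = no λ isthmus → ¬Sh (proj₁ isthmus)

-- The vertex permutation after deleting the edge {h₁, h₂}: deleteσ σ′ h₁ h₂ x
-- is σ′^(1+j) x for the least j ≤ 2 with σ′^(1+j) x ∉ {h₁, h₂} (or j = 2 if
-- there is none), and the half-edges skipped over all lie in {h₁, h₂}.
module Deletion {n : ℕ} (σ′ : Fin n → Fin n) (h₁ h₂ : Fin n) where
  open Iteration

  σd : Fin n → Fin n
  σd = deleteσ σ′ h₁ h₂

  Deleted : Fin n → Set
  Deleted x = x ∈e (h₁ , h₂) ≡ true

  record Skip (x : Fin n) : Set where
    field
      j       : ℕ
      lands   : σd x ≡ iter σ′ (suc j) x
      skipped : ∀ m → m < j → Deleted (iter σ′ (suc m) x)
      landing : iter σ′ (suc j) x ∈e (h₁ , h₂) ≡ false ⊎ (j ≡ 2 × Deleted (iter σ′ 3 x))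

  private
    if-kept : ∀ {A : Set} b (y z : A) → b ≡ false → (if not b then y else z) ≡ y
    if-kept false y z refl = refl

    if-skipped : ∀ {A : Set} b (y z : A) → b ≡ true → (if not b then y else z) ≡ z
    if-skipped true y z refl = refl

  skip : ∀ x → Skip x
  skip x with σ′ x ∈e (h₁ , h₂) in e₁
  ... | false = record { j = 0 ; lands = if-kept _ _ _ e₁ ; skipped = λ _ () ; landing = inj₁ e₁ }
  ... | true with σ′ (σ′ x) ∈e (h₁ , h₂) in e₂
  ...   | false = record { j = 1 ; lands = trans (if-skipped _ _ _ e₁) (if-kept _ _ _ e₂)
                         ; skipped = λ { zero _ → e₁ ; (suc m) (s≤s ()) } ; landing = inj₁ e₂ }
  ...   | true = record { j = 2 ; lands = trans (if-skipped _ _ _ e₁) (if-skipped _ _ _ e₂)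
                        ; skipped = λ { zero _ → e₁ ; (suc zero) _ → e₂ ; (suc (suc m)) (s≤s (s≤s ())) }
                        ; landing = landing₃ (σ′ (σ′ (σ′ x)) ∈e (h₁ , h₂)) refl }
    where
      landing₃ : ∀ b → σ′ (σ′ (σ′ x)) ∈e (h₁ , h₂) ≡ b
               → σ′ (σ′ (σ′ x)) ∈e (h₁ , h₂) ≡ false ⊎ (2 ≡ 2 × Deleted (σ′ (σ′ (σ′ x))))
      landing₃ false e = inj₁ e
      landing₃ true  e = inj₂ (refl , e)

  iter-σd : ∀ k x → ∃ λ K → iter σd k x ≡ iter σ′ K x
  iter-σd zero    x = 0 , refl
  iter-σd (suc k) x with iter-σd k x
  ... | K , eq = suc (Skip.j s) + K , (begin
      σd (iter σd k x)                   ≡⟨ cong σd eq ⟩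
      σd (iter σ′ K x)                   ≡⟨ Skip.lands s ⟩
      iter σ′ (suc (Skip.j s)) (iter σ′ K x) ≡⟨ sym (iter-+ σ′ (suc (Skip.j s)) K x) ⟩
      iter σ′ (suc (Skip.j s) + K) x     ∎)
    where
      s = skip (iter σ′ K x)
      open ≡-Reasoning

  σd-vertex⇒σ′-vertex : ∀ {x y} → SameVertex σd x y → SameVertex σ′ x y
  σd-vertex⇒σ′-vertex {x} (k , e) with iter-σd k x
  ... | K , eq = K , trans (sym eq) e

  after-skip : ∀ {x k} → Skip.j (skip x) ≤ k → iter σ′ (k ∸ Skip.j (skip x)) (σd x) ≡ iter σ′ (suc k) x
  after-skip {x} {k} j≤k = begin
    iter σ′ (k ∸ j) (σd x)                 ≡⟨ cong (iter σ′ (k ∸ j)) (Skip.lands (skip x)) ⟩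
    iter σ′ (k ∸ j) (iter σ′ (suc j) x)    ≡⟨ sym (iter-+ σ′ (k ∸ j) (suc j) x) ⟩
    iter σ′ (k ∸ j + suc j) x              ≡⟨ cong (λ m → iter σ′ m x) (trans (+-suc (k ∸ j) j) (cong suc (m∸n+n≡m j≤k))) ⟩
    iter σ′ (suc k) x                      ∎
    where
      j = Skip.j (skip x)
      open ≡-Reasoning

  σ′-vertex⇒σd-vertex : ∀ {x y} → y ∈e (h₁ , h₂) ≡ false → SameVertex σ′ x y → SameVertex σd x y
  σ′-vertex⇒σd-vertex {x} {y} y-kept (k , e) = go k x (<-wellFounded k) e
    where
      go : ∀ k x → Acc _<_ k → iter σ′ k x ≡ y → SameVertex σd x y
      go zero    x _        e = 0 , e
      go (suc k) x (acc rs) e with Skip.j (skip x) ≤? k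
      ... | no j≰k = ⊥-elim (true≢false (subst Deleted e (Skip.skipped (skip x) k (≰⇒> j≰k))) y-kept)
      ... | yes j≤k with go (k ∸ Skip.j (skip x)) (σd x) (rs (s≤s (m∸n≤m k (Skip.j (skip x))))) (trans (after-skip j≤k) e)
      ...   | k′ , e′ = suc k′ , trans (iter-suc σd k′ x) e′

  module OnLive (Live : Fin n → Set) (closed : ∀ x → Live x → Live (σ′ x))
                (inj : ∀ x y → Live x → Live y → σ′ x ≡ σ′ y → x ≡ y) where
    open InjectiveOn Live σ′ closed inj

    Survivor : Fin n → Set
    Survivor x = Live x × x ∈e (h₁ , h₂) ≡ false

    -- three consecutive σ′-images of a survivor are pairwise distinct, so
    -- they cannot all lie in {h₁, h₂}
    no-triple-skip : ∀ {x} → Survivor x → Deleted (σ′ x) → Deleted (σ′ (σ′ x)) → Deleted (σ′ (σ′ (σ′ x))) → ⊥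
    no-triple-skip {x} (Lx , x-kept) d₁ d₂ d₃ = pair-pigeonhole d₁ d₂ d₃ a≢b (λ b≡c → a≢b (inj _ _ La Lb b≡c))
        (λ a≡c → true≢false (subst Deleted (sym (inj _ _ Lx Lb a≡c)) d₂) x-kept)
      where
        La = closed x Lx
        Lb = closed _ La
        a≢b : σ′ x ≢ σ′ (σ′ x)
        a≢b a≡b = true≢false (subst Deleted (sym (inj _ _ Lx La a≡b)) d₁) x-kept

    survivor-closed : ∀ x → Survivor x → Survivor (σd x)
    survivor-closed x sx@(Lx , _) with skip x
    ... | record { j = j ; lands = lands ; landing = inj₁ kept } =
          subst Survivor (sym lands) (iter-preserves Live σ′ closed (suc j) x Lx , kept)
    ... | record { skipped = skipped ; landing = inj₂ (refl , d₃) } =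
          ⊥-elim (no-triple-skip sx (skipped 0 (s≤s z≤n)) (skipped 1 (s≤s (s≤s z≤n))) d₃)

    -- σd x ≡ σd y with a shorter jump from x would make x a skipped
    -- half-edge of the jump from y
    shorter-jump : ∀ {x y} → Survivor x → Live y → σd x ≡ σd y → Skip.j (skip x) < Skip.j (skip y) → ⊥
    shorter-jump {x} {y} (Lx , x-kept) Ly e i<j with m≤n⇒∃[o]m+o≡n i<j
    ... | d , 1+i+d≡j = true≢false (subst Deleted (sym x≡) (Skip.skipped (skip y) d d<j)) x-kept
      where
        i = Skip.j (skip x)
        d<j : d < Skip.j (skip y)
        d<j = ≤-trans (s≤s (m≤n+m d i)) (≤-reflexive 1+i+d≡j)
        x≡ : x ≡ iter σ′ (suc d) y
        x≡ = iter-cancel (suc i) Lx (iter-preserves Live σ′ closed (suc d) y Ly) (begin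
          iter σ′ (suc i) x              ≡⟨ sym (Skip.lands (skip x)) ⟩
          σd x                           ≡⟨ e ⟩
          σd y                           ≡⟨ Skip.lands (skip y) ⟩
          iter σ′ (suc (Skip.j (skip y))) y ≡⟨ cong (λ m → iter σ′ (suc m) y) (sym 1+i+d≡j) ⟩
          iter σ′ (suc (suc i + d)) y    ≡⟨ cong (λ m → iter σ′ m y) (sym (+-suc (suc i) d)) ⟩
          iter σ′ (suc i + suc d) y      ≡⟨ iter-+ σ′ (suc i) (suc d) y ⟩
          iter σ′ (suc i) (iter σ′ (suc d) y) ∎)
          where open ≡-Reasoning

    survivor-injective : ∀ x y → Survivor x → Survivor y → σd x ≡ σd y → x ≡ y
    survivor-injective x y sx sy e with <-cmp (Skip.j (skip x)) (Skip.j (skip y))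
    ... | tri< i<j _ _ = ⊥-elim (shorter-jump sx (proj₁ sy) e i<j)
    ... | tri> _ _ j<i = ⊥-elim (shorter-jump sy (proj₁ sx) (sym e) j<i)
    ... | tri≈ _ i≡j _ = iter-cancel (suc (Skip.j (skip x))) (proj₁ sx) (proj₁ sy) (begin
          iter σ′ (suc (Skip.j (skip x))) x ≡⟨ sym (Skip.lands (skip x)) ⟩
          σd x                              ≡⟨ e ⟩
          σd y                              ≡⟨ Skip.lands (skip y) ⟩
          iter σ′ (suc (Skip.j (skip y))) y ≡⟨ cong (λ m → iter σ′ (suc m) y) (sym i≡j) ⟩
          iter σ′ (suc (Skip.j (skip x))) y ∎)
      where open ≡-Reasoning

first-revisit : (R : ℕ → ℕ → Set) → (∀ a b → Dec (R a b)) → ∀ N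
              → (Σ ℕ λ b → b < N × Σ ℕ λ a → a < b × R a b)
              → Σ ℕ λ j → Σ ℕ λ i → i < j × R i j × (∀ k l → k < l → l < j → ¬ R k l)
first-revisit R R? N (b , b<N , a , a<b , Rab) with least-below Earlier decEarlier N
  where
    Earlier : ℕ → Set
    Earlier l = Σ ℕ λ k → k < l × R k l
    decEarlier : ∀ l → Dec (Earlier l)
    decEarlier l with least-below (λ k → R k l) (λ k → R? k l) l
    ... | inj₁ (k , k<l , Rkl , _) = yes (k , k<l , Rkl)
    ... | inj₂ none = no λ { (k , k<l , Rkl) → none k k<l Rkl }
... | inj₁ (j , _ , (i , i<j , Rij) , before) = j , i , i<j , Rij , λ k l k<l l<j Rkl → before l l<j (k , k<l , Rkl)
... | inj₂ none = ⊥-elim (none b b<N (a , a<b , Rab))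

clamp : ∀ m → ℕ → Fin (suc m)
clamp m       zero    = zero
clamp zero    (suc k) = zero
clamp (suc m) (suc k) = suc (clamp m k)

toℕ-clamp : ∀ m k → k ≤ m → toℕ (clamp m k) ≡ k
toℕ-clamp m       zero    _         = refl
toℕ-clamp (suc m) (suc k) (s≤s k≤m) = cong suc (toℕ-clamp m k k≤m)

clamp-toℕ : ∀ m (i : Fin (suc m)) → clamp m (toℕ i) ≡ i
clamp-toℕ m       zero    = refl
clamp-toℕ (suc m) (suc i) = cong suc (clamp-toℕ m i)

module MapFacts {n : ℕ} (σ : Permutation′ n) (α : Fin n → Fin n) (isMap : IsMap σ α) where
  open IsMap isMap
  open Iteration

  σf : Fin n → Fin n
  σf x = σ ⟨$⟩ʳ x

  σf-injective : ∀ x y → σf x ≡ σf y → x ≡ y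
  σf-injective x y e = trans (sym (inverseˡ σ)) (trans (cong (σ ⟨$⟩ˡ_) e) (inverseˡ σ))

  private
    module σ-Orbits = InjectiveOn (λ _ → ⊤) σf (λ _ _ → tt) (λ x y _ _ → σf-injective x y)

  σ-vertex-sym : ∀ {x y} → SameVertex σf x y → SameVertex σf y x
  σ-vertex-sym = σ-Orbits.sv-sym tt

  decσ-vertex : ∀ x y → Dec (SameVertex σf x y)
  decσ-vertex x y = σ-Orbits.decSV y tt

  α-injective : ∀ a b → α a ≡ α b → a ≡ b
  α-injective a b e = trans (sym (α-invol a)) (trans (cong α e) (α-invol b))

  α-pair : ∀ h x → α x ∈e (h , α h) ≡ x ∈e (h , α h)
  α-pair h x = bool-ext to from
    where
      to : α x ∈e (h , α h) ≡ true → x ∈e (h , α h) ≡ true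
      to e with ∈e-elim (α x) h (α h) e
      ... | inj₁ αx≡h  = subst (λ z → z ∈e (h , α h) ≡ true) (sym (trans (sym (α-invol x)) (cong α αx≡h))) (∈e-r h (α h))
      ... | inj₂ αx≡αh = subst (λ z → z ∈e (h , α h) ≡ true) (sym (α-injective x h αx≡αh)) (∈e-l h (α h))
      from : x ∈e (h , α h) ≡ true → α x ∈e (h , α h) ≡ true
      from e with ∈e-elim x h (α h) e
      ... | inj₁ refl = ∈e-r x (α x)
      ... | inj₂ refl = subst (λ z → z ∈e (h , α h) ≡ true) (sym (α-invol h)) (∈e-l h (α h))

  ConnDel-swap : ∀ {S σ′} h {a b} → ConnDel S σ′ α (α h) a b → ConnDel S σ′ α h a b
  ConnDel-swap h (vtx p)       = vtx p
  ConnDel-swap h (edge s p q)  = edge s (λ e → q (trans e (sym (α-invol h)))) p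
  ConnDel-swap h (sym′ c)      = sym′ (ConnDel-swap h c)
  ConnDel-swap h (trans′ c d)  = trans′ (ConnDel-swap h c) (ConnDel-swap h d)

  -- Every edge of a cycle of S is bypassed by the rest of the cycle: in any
  -- map σ′ on S whose vertices are those of σ, the endpoints of the edge
  -- remain connected after deleting it.
  module CycleBypass (S : EdgeSet n) (σ′ : Fin n → Fin n) (S-α : ∀ x → S (α x) ≡ S x)
                     (σ-vertex⇒σ′-vertex : ∀ x y → S x ≡ true → S y ≡ true → SameVertex σf x y → SameVertex σ′ x y)
                     (C : Cycle σ α S) (i : Fin (suc (Cycle.m C))) where
    open Cycle C

    W : ℕ → Fin n
    W k = w (clamp m k)

    e : ℕ
    e = toℕ i

    W-e : W e ≡ w i
    W-e = cong w (clamp-toℕ m i)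

    Avoiding : Fin n → Fin n → Set
    Avoiding a b = ConnDel S σ′ α (w i) a b

    at-vertex : ∀ {a b} → S a ≡ true → S b ≡ true → SameVertex σf a b → Avoiding a b
    at-vertex Sa Sb p = vtx (σ-vertex⇒σ′-vertex _ _ Sa Sb p)

    other-edge : ∀ k → k ≤ m → k ≢ e → Avoiding (W k) (α (W k))
    other-edge k k≤m k≢e with edgesDist (clamp m k) i (λ eq → k≢e (trans (sym (toℕ-clamp m k k≤m)) (cong toℕ eq)))
    ... | p , q = edge (inT _) p q

    consecutive : ∀ k → k < m → Avoiding (α (W k)) (W (suc k))
    consecutive k k<m = subst₂ (λ a b → Avoiding (α (w a)) (w b)) source target
      (at-vertex (trans (S-α _) (inT _)) (inT _) (consec (fromℕ< k<m)))
      where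
        source : inject₁ (fromℕ< k<m) ≡ clamp m k
        source = toℕ-injective (trans (toℕ-inject₁ (fromℕ< k<m))
                 (trans (toℕ-fromℕ< k<m) (sym (toℕ-clamp m k (<⇒≤ k<m)))))
        target : suc (fromℕ< k<m) ≡ clamp m (suc k)
        target = toℕ-injective (trans (cong suc (toℕ-fromℕ< k<m)) (sym (toℕ-clamp m (suc k) k<m)))

    wrap-around : Avoiding (α (W m)) (W 0)
    wrap-around = subst (λ a → Avoiding (α (w a)) (w zero)) last
      (at-vertex (trans (S-α _) (inT _)) (inT _) closing)
      where
        last : fromℕ m ≡ clamp m m
        last = toℕ-injective (trans (toℕ-fromℕ m) (sym (toℕ-clamp m m ≤-refl)))

    after : ∀ k → e < k → k ≤ m → Avoiding (α (w i)) (W k)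
    after (suc k) e<1+k 1+k≤m with k ≟ e
    ... | yes refl = subst (λ a → Avoiding (α a) (W (suc k))) W-e (consecutive k 1+k≤m)
    ... | no k≢e   = trans′ (after k (≤∧≢⇒< (≤-pred e<1+k) (λ p → k≢e (sym p))) (<⇒≤ 1+k≤m))
                      (trans′ (other-edge k (<⇒≤ 1+k≤m) k≢e) (consecutive k 1+k≤m))

    up-to : ∀ k → k ≤ e → Avoiding (W 0) (W k)
    up-to zero    _     = vtx (0 , refl)
    up-to (suc k) 1+k≤e = trans′ (up-to k (<⇒≤ 1+k≤e))
      (trans′ (other-edge k (≤-trans (<⇒≤ 1+k≤e) e≤m) (<⇒≢ 1+k≤e)) (consecutive k (≤-trans 1+k≤e e≤m)))
      where
        e≤m : e ≤ m
        e≤m = ≤-pred (toℕ<n i)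

    reach-e : Avoiding (W 0) (w i)
    reach-e = subst (Avoiding (W 0)) W-e (up-to e ≤-refl)

    bypass : Avoiding (α (w i)) (w i)
    bypass with e ≟ m
    ... | yes e≡m = trans′ (subst (λ a → Avoiding (α a) (W 0)) (trans (cong W (sym e≡m)) W-e) wrap-around) reach-e
    ... | no e≢m  = trans′ (after m (≤∧≢⇒< (≤-pred (toℕ<n i)) e≢m) ≤-refl)
                      (trans′ (other-edge m ≤-refl (λ p → e≢m (sym p))) (trans′ wrap-around reach-e))

  -- The walk is a sequence of half-edges Y k of T such that Y (1+k) lies at
  -- the vertex α (Y k) leads to and is not α (Y k) itself; cutting it at its
  -- first return to an earlier vertex gives the cycle.
  module WalkCycle (T : EdgeSet n) (Y : ℕ → Fin n) (Y-T : ∀ k → T (Y k) ≡ true)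
                   (Y-step : ∀ k → SameVertex σf (α (Y k)) (Y (suc k)))
                   (Y-turn : ∀ k → Y (suc k) ≢ α (Y k)) where

    SV : ℕ → ℕ → Set
    SV k l = SameVertex σf (Y k) (Y l)

    -- among the first n+1 half-edges of the walk two coincide
    some-revisit : Σ ℕ λ b → b < suc n × Σ ℕ λ a → a < b × SV a b
    some-revisit with pigeonhole (n<1+n n) (λ (i : Fin (suc n)) → Y (toℕ i))
    ... | i , j , i<j , e = toℕ j , toℕ<n j , toℕ i , i<j , (0 , e)

    -- abstract, so that the search is never unfolded during type checking
    abstract
      revisit : Σ ℕ λ j → Σ ℕ λ i → i < j × SV i j × (∀ k l → k < l → l < j → ¬ SV k l)
      revisit = first-revisit SV (λ a b → decσ-vertex (Y a) (Y b)) (suc n) some-revisit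

    j : ℕ
    j = proj₁ revisit

    i₀ : ℕ
    i₀ = proj₁ (proj₂ revisit)

    i₀<j : i₀ < j
    i₀<j = proj₁ (proj₂ (proj₂ revisit))

    returns : SV i₀ j
    returns = proj₁ (proj₂ (proj₂ (proj₂ revisit)))

    distinct : ∀ k l → k < j → l < j → k ≢ l → ¬ SV k l
    distinct k l k<j l<j k≢l s with <-cmp k l
    ... | tri< k<l _ _ = proj₂ (proj₂ (proj₂ (proj₂ revisit))) k l k<l l<j s
    ... | tri≈ _ k≡l _ = k≢l k≡l
    ... | tri> _ _ l<k = proj₂ (proj₂ (proj₂ (proj₂ revisit))) l k l<k k<j (σ-vertex-sym s)

    -- Y K = α (Y L) would make the walk return to the vertex of Y K
    -- at step L + 1, too early
    no-reverse : ∀ K L → i₀ ≤ K → K < j → i₀ ≤ L → L < j → K ≢ L → Y K ≢ α (Y L)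
    no-reverse K L i₀≤K K<j i₀≤L L<j K≢L eq with m≤n⇒m<n∨m≡n L<j
    ... | inj₁ 1+L<j with K ≟ suc L
    ...   | yes K≡1+L = Y-turn L (trans (cong Y (sym K≡1+L)) eq)
    ...   | no K≢1+L  = distinct K (suc L) K<j 1+L<j K≢1+L (subst (λ a → SameVertex σf a (Y (suc L))) (sym eq) (Y-step L))
    no-reverse K L i₀≤K K<j i₀≤L L<j K≢L eq | inj₂ 1+L≡j with K ≟ i₀
    ... | no K≢i₀ = distinct K i₀ K<j i₀<j K≢i₀
          (sv-trans σf (subst (SV K) 1+L≡j (subst (λ a → SameVertex σf a (Y (suc L))) (sym eq) (Y-step L)))
                       (σ-vertex-sym returns))
    ... | yes refl with L ≟ suc i₀
    ...   | yes refl = Y-turn i₀ (sym αY)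
      where αY : α (Y K) ≡ Y L
            αY = trans (cong α eq) (α-invol (Y L))
    ...   | no L≢1+i₀ = distinct L (suc i₀) L<j (≤-<-trans (≤∧≢⇒< i₀≤L K≢L) L<j) L≢1+i₀
            (subst (λ a → SameVertex σf a (Y (suc i₀))) (trans (cong α eq) (α-invol (Y L))) (Y-step i₀))

    -- the cycle Y i₀, …, Y (j-1)
    len : ℕ
    len = proj₁ (m≤n⇒∃[o]m+o≡n i₀<j)

    len-eq : suc (i₀ + len) ≡ j
    len-eq = proj₂ (m≤n⇒∃[o]m+o≡n i₀<j)

    index-bound : ∀ (k : Fin (suc len)) → i₀ + toℕ k < j
    index-bound k = ≤-trans (s≤s (+-monoʳ-≤ i₀ (≤-pred (toℕ<n k)))) (≤-reflexive len-eq)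

    index-injective : ∀ (a b : Fin (suc len)) → a ≢ b → i₀ + toℕ a ≢ i₀ + toℕ b
    index-injective a b a≢b e = a≢b (toℕ-injective (+-cancelˡ-≡ i₀ _ _ e))

    cycle : Cycle σ α T
    cycle = record
      { m = len
      ; w = λ k → Y (i₀ + toℕ k)
      ; inT = λ k → Y-T (i₀ + toℕ k)
      ; consec = λ k → subst₂ (λ a b → SameVertex σf (α (Y a)) (Y b))
                         (cong (i₀ +_) (sym (toℕ-inject₁ k))) (sym (+-suc i₀ (toℕ k))) (Y-step (i₀ + toℕ k))
      ; closing = subst₂ (λ a b → SameVertex σf (α (Y a)) (Y b))
                    (cong (i₀ +_) (sym (toℕ-fromℕ len))) (sym (+-identityʳ i₀))
                    (sv-trans σf (subst (SameVertex σf (α (Y (i₀ + len)))) (cong Y len-eq) (Y-step (i₀ + len)))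
                                 (σ-vertex-sym returns))
      ; edgesDist = λ a b a≢b → (λ e → distinct _ _ (index-bound a) (index-bound b) (index-injective a b a≢b) (0 , e))
                                , no-reverse _ _ (m≤m+n i₀ _) (index-bound a) (m≤m+n i₀ _) (index-bound b) (index-injective a b a≢b)
      ; vertsDist = λ a b a≢b → distinct _ _ (index-bound a) (index-bound b) (index-injective a b a≢b)
      }

module Procedure {n : ℕ} (σ : Permutation′ n) (α : Fin n → Fin n) (F : EdgeSet n)
                 (isMap : IsMap σ α) (forest : SpanningForest σ α F) where
  open IsMap isMap
  open MapFacts σ α isMap
  open Iteration

  F-α : ClosedUnderα α F
  F-α = proj₁ forest

  F-acyclic : Acyclic σ α F
  F-acyclic = proj₂ forest

  -- The invariant of the states of τ: current half-edge h, current map with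
  -- half-edges S and vertex permutation σ′, visited half-edges V.
  record Invariant (h : Fin n) (S : EdgeSet n) (σ′ : Fin n → Fin n) (V : EdgeSet n) : Set where
    field
      S-α                : ∀ x → S (α x) ≡ S x
      V-α                : ∀ x → V (α x) ≡ V x
      σ′-live            : ∀ x → S x ≡ true → S (σ′ x) ≡ true
      σ′-injective       : ∀ x y → S x ≡ true → S y ≡ true → σ′ x ≡ σ′ y → x ≡ y
      σ′-within-σ        : ∀ x → SameVertex σf x (σ′ x)
      σ-vertex⇒σ′-vertex : ∀ x y → S x ≡ true → S y ≡ true → SameVertex σf x y → SameVertex σ′ x y
      deleted-visited    : ∀ x → S x ≡ false → V x ≡ true
      deleted-∉F         : ∀ x → S x ≡ false → F x ≡ false
      connected          : Connected σ α S
      -- visited edges of M′ outside F were kept because they are isthmuses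
      kept-isthmus       : ∀ x → S x ≡ true → V x ≡ true → F x ≡ false → ¬ ConnDel S σ′ α x x (α x)
      current-ok         : S h ≡ false → S (σ′ (α h)) ≡ true ⊎ (∀ x → V x ≡ true)

  Inv : State n → Set
  Inv (st h S σ′ V) = Invariant h S σ′ V

  module _ {h S σ′ V} (I : Invariant h S σ′ V) where
    open Invariant I

    S-α-true : ∀ {x} → S x ≡ true → S (α x) ≡ true
    S-α-true {x} Sx = trans (S-α x) Sx

    σ′-iterate-within-σ : ∀ k x → SameVertex σf x (iter σ′ k x)
    σ′-iterate-within-σ zero    x = 0 , refl
    σ′-iterate-within-σ (suc k) x = sv-trans σf (σ′-iterate-within-σ k x) (σ′-within-σ (iter σ′ k x))

    -- A set P of half-edges that contains a live half-edge and is closed,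
    -- on live half-edges, under α and σ′ contains every live half-edge:
    -- the set of half-edges at a vertex carrying a live member of P is
    -- respected by the connectivity of (V(G), S).
    covers : (P : Fin n → Set) → (∀ z → S z ≡ true → P z → P (α z)) → (∀ z → S z ≡ true → P z → P (σ′ z))
           → ∀ {x} → S x ≡ true → P x → ∀ z → S z ≡ true → P z
    covers P P-α P-σ′ {x} Sx Px z Sz = Q⇒P z Sz (proj₁ (respects (connected x z)) (x , Sx , Px , (0 , refl)))
      where
        Q : Fin n → Set
        Q z = Σ (Fin n) λ y → S y ≡ true × P y × SameVertex σf y z

        Q⇒P : ∀ z → S z ≡ true → Q z → P z
        Q⇒P z Sz (y , Sy , Py , p) with σ-vertex⇒σ′-vertex y z Sy Sz p
        ... | k , refl = proj₂ (iter-preserves (λ y → S y ≡ true × P y) σ′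
                                  (λ y (Sy , Py) → σ′-live y Sy , P-σ′ y Sy Py) k y (Sy , Py))

        respects : ∀ {a b} → ConnT σ α S a b → (Q a → Q b) × (Q b → Q a)
        respects (vtx p) = (λ (y , Sy , Py , q) → y , Sy , Py , sv-trans σf q p)
                         , (λ (y , Sy , Py , q) → y , Sy , Py , sv-trans σf q (σ-vertex-sym p))
        respects (edge {z} Sz) = (λ q → α z , S-α-true Sz , P-α z Sz (Q⇒P z Sz q) , (0 , refl))
                               , (λ q → z , Sz , subst P (α-invol z) (P-α (α z) (S-α-true Sz) (Q⇒P (α z) (S-α-true Sz) q)) , (0 , refl))
        respects (sym′ c)     = proj₂ (respects c) , proj₁ (respects c)
        respects (trans′ c d) = (λ q → proj₁ (respects d) (proj₁ (respects c) q))
                              , (λ q → proj₂ (respects c) (proj₂ (respects d) q))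


  dead-edge : ∀ {S : EdgeSet n} → (∀ x → S (α x) ≡ S x) → ∀ h → S h ≡ false → ∀ z → z ∈e (h , α h) ≡ true → S z ≡ false
  dead-edge {S} S-α h ¬Sh z z∈ = [ (λ z≡h → subst (λ y → S y ≡ false) (sym z≡h) ¬Sh)
                                 , (λ z≡αh → subst (λ y → S y ≡ false) (sym z≡αh) (trans (S-α h) ¬Sh)) ]′ (∈e-elim z h (α h) z∈)

  isthmus-α : ∀ {S σ′} h → ¬ ConnDel S σ′ α h h (α h) → ¬ ConnDel S σ′ α (α h) (α h) (α (α h))
  isthmus-α {S} {σ′} h ¬c c = ¬c (sym′ (subst (ConnDel S σ′ α h (α h)) (α-invol h) (ConnDel-swap h c)))

  module _ {h : Fin n} {S S₁ V : EdgeSet n} {σ′ σ₁ : Fin n → Fin n} (I : Invariant h S σ′ V)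
           (back : ∀ {x a b} → ConnDel S₁ σ₁ α x a b → ConnDel S σ′ α x a b)
           (S₁⊆S : ∀ x → S₁ x ≡ true → S x ≡ true) (S₁-α : ∀ x → S₁ (α x) ≡ S₁ x)
           (h-isthmus : S₁ h ≡ true → F h ≡ false → ¬ ConnDel S₁ σ₁ α h h (α h)) where
    open Invariant I

    visited-isthmus : ∀ x → S₁ x ≡ true → mark V h (α h) x ≡ true → F x ≡ false → ¬ ConnDel S₁ σ₁ α x x (α x)
    visited-isthmus x S₁x Vx Fx with bool-cases (x ∈e (h , α h))
    ... | inj₂ x∉ = λ c → kept-isthmus x (S₁⊆S x S₁x) (mark-unmarked V h (α h) x Vx x∉) Fx (back c)
    ... | inj₁ x∈ with ∈e-elim x h (α h) x∈
    ...   | inj₁ x≡h  = subst (λ z → ¬ ConnDel S₁ σ₁ α z z (α z)) (sym x≡h)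
                          (h-isthmus (subst (λ z → S₁ z ≡ true) x≡h S₁x) (subst (λ z → F z ≡ false) x≡h Fx))
    ...   | inj₂ x≡αh = subst (λ z → ¬ ConnDel S₁ σ₁ α z z (α z)) (sym x≡αh)
                          (isthmus-α h (h-isthmus (trans (sym (S₁-α h)) S₁αh) (trans (sym (F-α h)) Fαh)))
      where
        S₁αh : S₁ (α h) ≡ true
        S₁αh = subst (λ z → S₁ z ≡ true) x≡αh S₁x
        Fαh : F (α h) ≡ false
        Fαh = subst (λ z → F z ≡ false) x≡αh Fx

  -- A keep step only marks the edge {h, α h} as visited.
  keep-preserves : ∀ {h S σ′ V} → Invariant h S σ′ V → Isthmus S σ′ α h ⊎ F h ≡ true
                 → Invariant (σ′ (α h)) S σ′ (mark V h (α h))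
  keep-preserves {h} {S} {σ′} {V} I why = record
    { S-α = S-α ; V-α = λ x → cong₂ _∨_ (V-α x) (α-pair h x)
    ; σ′-live = σ′-live ; σ′-injective = σ′-injective ; σ′-within-σ = σ′-within-σ
    ; σ-vertex⇒σ′-vertex = σ-vertex⇒σ′-vertex
    ; deleted-visited = λ x Sx → mark-old V h (α h) x (deleted-visited x Sx)
    ; deleted-∉F = deleted-∉F ; connected = connected
    ; kept-isthmus = visited-isthmus {h} {S} {S} {V} {σ′} {σ′} I (λ c → c) (λ _ Sx → Sx) S-α (λ _ → kept-not-bridged why)
    ; current-ok = λ dead → ⊥-elim (true≢false (σ′-live (α h) (S-α-true I (kept-live why))) dead) }
    where
      open Invariant I
      kept-live : Isthmus S σ′ α h ⊎ F h ≡ true → S h ≡ true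
      kept-live (inj₁ (Sh , _)) = Sh
      kept-live (inj₂ Fh) = [ (λ Sh → Sh) , (λ ¬Sh → ⊥-elim (true≢false Fh (deleted-∉F h ¬Sh))) ]′ (bool-cases (S h))
      kept-not-bridged : Isthmus S σ′ α h ⊎ F h ≡ true → F h ≡ false → ¬ ConnDel S σ′ α h h (α h)
      kept-not-bridged (inj₁ (_ , ¬c)) _  = ¬c
      kept-not-bridged (inj₂ Fh)       ¬Fh = ⊥-elim (true≢false Fh ¬Fh)

  module DeleteStep {h : Fin n} {S V : EdgeSet n} {σ′ : Fin n → Fin n} (I : Invariant h S σ′ V)
                    (unvisited : ∃ λ u → V u ≡ false) (Fh : F h ≡ false)
                    (bridge : S h ≡ true → ConnDel S σ′ α h h (α h)) where
    open Invariant I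
    open Deletion σ′ h (α h)
    open OnLive (λ x → S x ≡ true) σ′-live σ′-injective

    S₁ : EdgeSet n
    S₁ = removeE S h (α h)

    V₁ : EdgeSet n
    V₁ = mark V h (α h)

    survivor : ∀ {x} → S₁ x ≡ true → Survivor x
    survivor {x} = removeE-elim S h (α h) x

    survives : ∀ {x} → Survivor x → S₁ x ≡ true
    survives {x} (Sx , x∉) = removeE-intro S h (α h) x Sx x∉

    S₁-α : ∀ x → S₁ (α x) ≡ S₁ x
    S₁-α x = cong₂ (λ a b → a ∧ not b) (S-α x) (α-pair h x)

    σd-live : ∀ x → S₁ x ≡ true → S₁ (σd x) ≡ true
    σd-live x e = survives (survivor-closed x (survivor e))

    σd-injective : ∀ x y → S₁ x ≡ true → S₁ y ≡ true → σd x ≡ σd y → x ≡ y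
    σd-injective x y ex ey = survivor-injective x y (survivor ex) (survivor ey)

    σd-within-σ : ∀ x → SameVertex σf x (σd x)
    σd-within-σ x = subst (SameVertex σf x) (sym (Skip.lands (skip x))) (σ′-iterate-within-σ I (suc (Skip.j (skip x))) x)

    σ-vertex⇒σd-vertex : ∀ x y → S₁ x ≡ true → S₁ y ≡ true → SameVertex σf x y → SameVertex σd x y
    σ-vertex⇒σd-vertex x y ex ey p =
      σ′-vertex⇒σd-vertex (proj₂ (survivor ey)) (σ-vertex⇒σ′-vertex x y (proj₁ (survivor ex)) (proj₁ (survivor ey)) p)

    deleted-visited₁ : ∀ x → S₁ x ≡ false → V₁ x ≡ true
    deleted-visited₁ x e with removeE-false S h (α h) x e
    ... | inj₁ x∈  = mark-new V h (α h) x x∈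
    ... | inj₂ ¬Sx = mark-old V h (α h) x (deleted-visited x ¬Sx)

    deleted-∉F₁ : ∀ x → S₁ x ≡ false → F x ≡ false
    deleted-∉F₁ x e with removeE-false S h (α h) x e
    ... | inj₂ ¬Sx = deleted-∉F x ¬Sx
    ... | inj₁ x∈ with ∈e-elim x h (α h) x∈
    ...   | inj₁ x≡h  = subst (λ z → F z ≡ false) (sym x≡h) Fh
    ...   | inj₂ x≡αh = subst (λ z → F z ≡ false) (sym x≡αh) (trans (F-α h) Fh)

    avoiding : ∀ {a b} → ConnDel S σ′ α h a b → ConnT σ α S₁ a b
    avoiding (vtx (k , refl))    = vtx (σ′-iterate-within-σ I k _)
    avoiding (edge Sx x≢h x≢αh)  = edge (survives (Sx , ∉e x≢h x≢αh))
    avoiding (sym′ c)            = sym′ (avoiding c)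
    avoiding (trans′ c d)        = trans′ (avoiding c) (avoiding d)

    -- every edge of M′ joins vertices connected in the new map: the deleted
    -- one because it is bridged by a path avoiding it
    edge-persists : ∀ x → S x ≡ true → ConnT σ α S₁ x (α x)
    edge-persists x Sx = [ deleted , (λ x∉ → edge (survives (Sx , x∉))) ]′ (bool-cases (x ∈e (h , α h)))
      where
        h-bridged : S h ≡ true → ConnT σ α S₁ h (α h)
        h-bridged Sh = avoiding (bridge Sh)
        deleted : x ∈e (h , α h) ≡ true → ConnT σ α S₁ x (α x)
        deleted x∈ = [ (λ x≡h → subst (λ z → ConnT σ α S₁ z (α z)) (sym x≡h)
                                  (h-bridged (subst (λ z → S z ≡ true) x≡h Sx)))
                     , (λ x≡αh → subst (λ z → ConnT σ α S₁ z (α z)) (sym x≡αh)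
                                   (subst (ConnT σ α S₁ (α h)) (sym (α-invol h))
                                     (sym′ (h-bridged (trans (sym (S-α h)) (subst (λ z → S z ≡ true) x≡αh Sx)))))) ]′
                     (∈e-elim x h (α h) x∈)

    persists : ∀ {a b} → ConnT σ α S a b → ConnT σ α S₁ a b
    persists (vtx p)       = vtx p
    persists (edge {x} Sx) = edge-persists x Sx
    persists (sym′ c)      = sym′ (persists c)
    persists (trans′ c d)  = trans′ (persists c) (persists d)

    back : ∀ {x a b} → ConnDel S₁ σd α x a b → ConnDel S σ′ α x a b
    back (vtx p)         = vtx (σd-vertex⇒σ′-vertex p)
    back (edge Sx p q)   = edge (proj₁ (survivor Sx)) p q
    back (sym′ c)        = sym′ (back c)
    back (trans′ c d)    = trans′ (back c) (back d)

    -- If σ′ maps both h and α h into {h, α h}, then by connectivity every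
    -- live half-edge lies in {h, α h}, and everything is visited now.
    only-edge : S h ≡ true → Deleted (σ′ h) → Deleted (σ′ (α h)) → ∀ x → V₁ x ≡ true
    only-edge Sh d₁ d₂ x = [ (λ e → ⊥-elim (true≢false (all-deleted x (proj₁ (survivor e))) (proj₂ (survivor e))))
                           , deleted-visited₁ x ]′ (bool-cases (S₁ x))
      where
        D-α : ∀ z → S z ≡ true → Deleted z → Deleted (α z)
        D-α z _ d = trans (α-pair h z) d
        D-σ′ : ∀ z → S z ≡ true → Deleted z → Deleted (σ′ z)
        D-σ′ z _ d = [ (λ z≡h → subst (λ y → Deleted (σ′ y)) (sym z≡h) d₁)
                     , (λ z≡αh → subst (λ y → Deleted (σ′ y)) (sym z≡αh) d₂) ]′ (∈e-elim z h (α h) d)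
        all-deleted : ∀ z → S z ≡ true → Deleted z
        all-deleted = covers I Deleted D-α D-σ′ Sh (∈e-l h (α h))

    -- The new current half-edge c = σ′ (α h) is only deleted when it lies in
    -- {h, α h}; then σd (α c) is live unless {h, α h} was the last edge.
    current-ok₁ : S₁ (σ′ (α h)) ≡ false → S₁ (σd (α (σ′ (α h)))) ≡ true ⊎ (∀ x → V₁ x ≡ true)
    current-ok₁ dead with bool-cases (S h)
    ... | inj₂ ¬Sh = ⊥-elim (stale ¬Sh)
      where
        stale : S h ≡ false → ⊥
        stale ¬Sh with current-ok ¬Sh
        ... | inj₂ all-visited = true≢false (all-visited (proj₁ unvisited)) (proj₂ unvisited)
        ... | inj₁ Sc with removeE-false S h (α h) (σ′ (α h)) dead
        ...   | inj₁ c∈  = true≢false Sc (dead-edge S-α h ¬Sh _ c∈)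
        ...   | inj₂ ¬Sc = true≢false Sc ¬Sc
    ... | inj₁ Sh with removeE-false S h (α h) (σ′ (α h)) dead
    ...   | inj₂ ¬Sc = ⊥-elim (true≢false (σ′-live (α h) (S-α-true I Sh)) ¬Sc)
    ...   | inj₁ c∈ with skip (α (σ′ (α h)))
    ...     | record { j = j ; lands = lands ; landing = inj₁ kept } = inj₁ (subst (λ z → S₁ z ≡ true) (sym lands)
                (survives (iter-preserves (λ z → S z ≡ true) σ′ σ′-live (suc j) _ (S-α-true I (σ′-live (α h) (S-α-true I Sh))) , kept)))
    ...     | record { skipped = skipped ; landing = inj₂ (refl , _) } =
              inj₂ (only-edge Sh ([ via-h , via-αh ]′ (∈e-elim (α c) h (α h) (trans (α-pair h c) c∈))) c∈)
      where
        c : Fin n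
        c = σ′ (α h)
        via-h : α c ≡ h → Deleted (σ′ h)
        via-h αc≡h = subst (λ y → Deleted (σ′ y)) αc≡h (skipped 0 (s≤s z≤n))
        via-αh : α c ≡ α h → Deleted (σ′ h)
        via-αh αc≡αh = subst (λ y → Deleted (σ′ y)) (trans (cong σ′ αc≡αh) (α-injective c h αc≡αh))
                         (skipped 1 (s≤s (s≤s z≤n)))

    preserved : Invariant (σ′ (α h)) S₁ σd V₁
    preserved = record
      { S-α = S₁-α ; V-α = λ x → cong₂ _∨_ (V-α x) (α-pair h x)
      ; σ′-live = σd-live ; σ′-injective = σd-injective ; σ′-within-σ = σd-within-σ
      ; σ-vertex⇒σ′-vertex = σ-vertex⇒σd-vertex
      ; deleted-visited = deleted-visited₁ ; deleted-∉F = deleted-∉F₁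
      ; connected = λ x y → persists (connected x y)
      ; kept-isthmus = visited-isthmus {h} {S} {S₁} {V} {σ′} {σd} I back (λ x e → proj₁ (survivor e)) S₁-α
                         (λ S₁h _ → ⊥-elim (true≢false (∈e-l h (α h)) (proj₂ (survivor S₁h))))
      ; current-ok = current-ok₁ }

  step-preserves : ∀ {s s′} → Inv s → Step α F s s′ → Inv s′
  step-preserves {st h S σ′ V} I (delete unvisited ¬isthmus Fh) = DeleteStep.preserved I unvisited Fh bridge
    where
      bridge : S h ≡ true → ConnDel S σ′ α h h (α h)
      bridge Sh with DeletedConnectivity.decConnDel S σ′ α h h (α h)
      ... | yes c = c
      ... | no ¬c = ⊥-elim (¬isthmus (Sh , ¬c))
  step-preserves I (keep _ why) = keep-preserves I why

  run-preserves : ∀ {s s′} → Inv s → Run α F s s′ → Inv s′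
  run-preserves I ε          = I
  run-preserves I (step ◅ r) = run-preserves (step-preserves I step) r

  -- initially M′ = M, which is connected since ⟨σ, α⟩ is transitive
  orbit-connected : ∀ {x y} → Orbit σ α x y → ConnT σ α (λ _ → true) x y
  orbit-connected here       = vtx (0 , refl)
  orbit-connected (stepσ o)  = trans′ (orbit-connected o) (vtx (1 , refl))
  orbit-connected (stepσ⁻ o) = trans′ (orbit-connected o) (sym′ (vtx (1 , inverseʳ σ)))
  orbit-connected (stepα o)  = trans′ (orbit-connected o) (edge refl)

  initial : ∀ root → Inv (initState σ root)
  initial root = record
    { S-α = λ _ → refl ; V-α = λ _ → refl ; σ′-live = λ _ _ → refl
    ; σ′-injective = λ x y _ _ → σf-injective x y ; σ′-within-σ = λ x → 1 , refl
    ; σ-vertex⇒σ′-vertex = λ x y _ _ p → p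
    ; deleted-visited = λ _ () ; deleted-∉F = λ _ () ; connected = λ x y → orbit-connected (transitive x y)
    ; kept-isthmus = λ _ _ () ; current-ok = λ () }

  -- Once everything is visited, every edge of M′ outside F is an isthmus, so
  -- a cycle of M′ would lie in F; hence M′ is a spanning tree.
  final-tree : ∀ {h S σ′ V} → Invariant h S σ′ V → (∀ x → V x ≡ true) → SpanningTree σ α S
  final-tree {h} {S} {σ′} {V} I all-visited = S-α , connected , acyclic
    where
      open Invariant I
      acyclic : Acyclic σ α S
      acyclic C with all? (λ i → F (Cycle.w C i) ≟B true)
      ... | yes in-F = F-acyclic (record { m = m ; w = w ; inT = in-F ; consec = consec ; closing = closing
                                        ; edgesDist = edgesDist ; vertsDist = vertsDist })
        where open Cycle C
      ... | no ¬in-F with ¬∀⟶∃¬ _ _ (λ i → F (Cycle.w C i) ≟B true) ¬in-F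
      ...   | i , ∉F = kept-isthmus (Cycle.w C i) (Cycle.inT C i) (all-visited _) (¬-not ∉F)
                         (sym′ (CycleBypass.bypass S σ′ S-α σ-vertex⇒σ′-vertex C i))

  -- A half-edge is keepable when visiting it again changes nothing: it is
  -- visited and τ keeps it.
  Keepable : EdgeSet n → (Fin n → Fin n) → EdgeSet n → Fin n → Set
  Keepable S σ′ V y = V y ≡ true × (Isthmus S σ′ α y ⊎ F y ≡ true)

  -- With M′ fixed, τ moves along the face permutation
  -- φ = σ′ ∘ α.  If all half-edges of the face of a live x were keepable
  -- while some edge is unvisited, we get a contradiction: either the face
  -- is closed under α and then, by connectivity, it is the whole map, which
  -- is then entirely visited; or some edge y has only one side on the face,
  -- and such edges lie in F and form a cycle, contradicting acyclicity of F.
  module FaceWalk {x S σ′ V} (I : Invariant x S σ′ V) (Sx : S x ≡ true) where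
    open Invariant I

    φ : Fin n → Fin n
    φ y = σ′ (α y)

    Live : Fin n → Set
    Live y = S y ≡ true

    φ-live : ∀ y → Live y → Live (φ y)
    φ-live y Sy = σ′-live (α y) (S-α-true I Sy)

    φ-injective : ∀ a b → Live a → Live b → φ a ≡ φ b → a ≡ b
    φ-injective a b Sa Sb e = α-injective a b (σ′-injective (α a) (α b) (S-α-true I Sa) (S-α-true I Sb) e)

    module Faces = InjectiveOn Live φ φ-live φ-injective
    module Vertices = InjectiveOn Live σ′ σ′-live σ′-injective

    O : Fin n → Set
    O = SameVertex φ x

    -- kept abstract: only its answers matter, never its computation
    abstract
      decO : ∀ y → Dec (O y)
      decO y = Faces.decSV y Sx

    inO : Fin n → Bool
    inO y = ⌊ decO y ⌋

    O-live : ∀ {y} → O y → Live y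
    O-live (k , refl) = iter-preserves Live φ φ-live k x Sx

    O-φ : ∀ {y} → O y → O (φ y)
    O-φ (k , refl) = suc k , refl

    O-φ⁻ : ∀ {y} → Live y → O (φ y) → O y
    O-φ⁻ {y} Sy o with Faces.period y Sy
    ... | p , per = sv-trans φ o (p , trans (sym (iter-suc φ p y)) per)

    inO-σ′ : ∀ v → Live v → inO (σ′ v) ≡ inO (α v)
    inO-σ′ v Sv = bool-ext
      (λ e → decided-yes (decO _) (O-φ⁻ (S-α-true I Sv) (subst O (cong σ′ (sym (α-invol v))) (witness (decO _) e))))
      (λ e → decided-yes (decO _) (subst O (cong σ′ (α-invol v)) (O-φ (witness (decO _) e))))

    -- An edge with side y on the face and α y off it is not an isthmus: the
    -- face boundary leads from α y around to y without using the edge.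
    one-sided-bridged : ∀ {y} → O y → ¬ O (α y) → ConnDel S σ′ α y y (α y)
    one-sided-bridged {y} oy ¬oαy with Faces.period y (O-live oy)
    ... | p , per = sym′ (finish (walk p))
      where
        Path : Fin n → Set
        Path = ConnDel S σ′ α y (α y)

        walk : ∀ s → Path y ⊎ Path (iter φ (suc s) y)
        walk zero = inj₂ (vtx (1 , refl))
        walk (suc s) with walk s
        ... | inj₁ done = inj₁ done
        ... | inj₂ c with iter φ (suc s) y ≟F y
        ...   | yes z≡y = inj₁ (subst Path z≡y c)
        ...   | no z≢y  = inj₂ (trans′ c (trans′ (edge (O-live oz) z≢y (λ z≡αy → ¬oαy (subst O z≡αy oz))) (vtx (1 , refl))))
          where
            oz : O (iter φ (suc s) y)
            oz = sv-trans φ oy (suc s , refl)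

        finish : Path y ⊎ Path (iter φ (suc p) y) → Path y
        finish (inj₁ c) = c
        finish (inj₂ c) = subst Path per c

    module _ (keepable : ∀ {y} → O y → Keepable S σ′ V y) where

      one-sided-∈F : ∀ {y} → O y → ¬ O (α y) → F y ≡ true
      one-sided-∈F {y} oy ¬oαy with keepable oy
      ... | _ , inj₂ Fy          = Fy
      ... | _ , inj₁ (_ , ¬c)    = ⊥-elim (¬c (one-sided-bridged oy ¬oαy))

      Mixed : Fin n → Set
      Mixed y = inO y ≢ inO (α y)

      mixed-∈F : ∀ y → Mixed y → F y ≡ true
      mixed-∈F y mixed = [ on-face , off-face ]′ (bool-cases (inO y))
        where
          other-side : ∀ {b} → inO y ≡ b → inO (α y) ≡ not b
          other-side {b} e = ¬-not (λ e′ → mixed (trans e (sym e′)))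
          on-face : inO y ≡ true → F y ≡ true
          on-face e = one-sided-∈F (witness (decO y) e)
                        (λ oαy → true≢false (decided-yes (decO (α y)) oαy) (other-side e))
          off-face : inO y ≡ false → F y ≡ true
          off-face e = trans (sym (F-α y)) (one-sided-∈F (witness (decO (α y)) (other-side e))
                         (λ oααy → true≢false (decided-yes (decO y) (subst O (α-invol y) oααy)) e))

      -- If the face is closed under α it contains, by connectivity, every
      -- live half-edge; these are keepable, hence everything is visited.
      closed-face-visits-all : (∀ y → O y → O (α y)) → ∀ u → V u ≡ true
      closed-face-visits-all closed u = [ (λ Su → proj₁ (keepable (on-face u Su))) , deleted-visited u ]′ (bool-cases (S u))
        where
          O-σ′ : ∀ z → Live z → O z → O (σ′ z)
          O-σ′ z _ oz = subst O (cong σ′ (α-invol z)) (O-φ (closed z oz))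
          on-face : ∀ z → Live z → O z
          on-face = covers I O (λ z _ → closed z) O-σ′ Sx (0 , refl)

      -- Around the vertex reached through a mixed edge y the face is left and
      -- entered again, so another half-edge z at that vertex is mixed.
      record Successor (y : Fin n) : Set where
        field
          z       : Fin n
          z-live  : Live z
          z-mixed : Mixed z
          z-at    : SameVertex σf (α y) z
          z-turn  : z ≢ α y

      module Around (y : Fin n) (Sy : Live y) (mixed : Mixed y) where
        U : ℕ → Fin n
        U k = iter σ′ k (α y)

        U-live : ∀ k → Live (U k)
        U-live k = iter-preserves Live σ′ σ′-live k (α y) (S-α-true I Sy)

        Changes : ℕ → Set
        Changes i = inO (U (suc i)) ≢ inO (U (suc (suc i)))

        leaves : inO (U 1) ≢ inO (α y)
        leaves e = mixed (sym (trans (sym e) (trans (inO-σ′ (α y) (S-α-true I Sy)) (cong inO (α-invol y)))))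

        steady : ∀ k → (∀ j → j < k → ¬ Changes j) → inO (U 1) ≡ inO (U (suc k))
        steady zero    _    = refl
        steady (suc k) none = trans (steady k (λ j j<k → none j (m<n⇒m<1+n j<k)))
                                    (decidable-stable (_ ≟B _) (none k ≤-refl))

        successor : Successor y
        successor with Vertices.period (α y) (S-α-true I Sy)
        ... | d , per with least-below Changes (λ i → ¬? (inO (U (suc i)) ≟B inO (U (suc (suc i))))) d
        ...   | inj₂ none = ⊥-elim (leaves (trans (steady d none) (cong inO per)))
        ...   | inj₁ (i , _ , changes , first) = record
                { z = U (suc i) ; z-live = U-live (suc i)
                ; z-mixed = λ e → changes (trans e (sym (inO-σ′ (U (suc i)) (U-live (suc i)))))
                ; z-at = σ′-iterate-within-σ I (suc i) (α y)
                ; z-turn = λ e → leaves (trans (steady i first) (cong inO e)) }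

      MixedLive : Set
      MixedLive = Σ (Fin n) λ y → Live y × Mixed y

      next : MixedLive → MixedLive
      next (y , Sy , mixed) = z , z-live , z-mixed
        where open Successor (Around.successor y Sy mixed)

      walk : MixedLive → ℕ → MixedLive
      walk y₀ zero    = y₀
      walk y₀ (suc k) = next (walk y₀ k)

      -- a one-sided edge starts a non-backtracking walk of mixed edges,
      -- which lie in F and therefore cannot close a cycle
      no-one-sided : ∀ {y} → O y → ¬ O (α y) → ⊥
      no-one-sided {y} oy ¬oαy = F-acyclic (WalkCycle.cycle F Y Y-F Y-step Y-turn)
        where
          start : MixedLive
          start = y , O-live oy , λ e → true≢false (trans (sym e) (decided-yes (decO y) oy)) (decided-no (decO (α y)) ¬oαy)
          successor-of : ∀ k → Successor (proj₁ (walk start k))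
          successor-of k = Around.successor _ (proj₁ (proj₂ (walk start k))) (proj₂ (proj₂ (walk start k)))
          Y : ℕ → Fin n
          Y k = proj₁ (walk start k)
          Y-F : ∀ k → F (Y k) ≡ true
          Y-F k = mixed-∈F (Y k) (proj₂ (proj₂ (walk start k)))
          Y-step : ∀ k → SameVertex σf (α (Y k)) (Y (suc k))
          Y-step k = Successor.z-at (successor-of k)
          Y-turn : ∀ k → Y (suc k) ≢ α (Y k)
          Y-turn k = Successor.z-turn (successor-of k)

      keepable-face-absurd : (∃ λ u → V u ≡ false) → ⊥
      keepable-face-absurd (u , ¬Vu) with all? (λ y → decO y →-dec decO (α y))
      ... | yes closed = true≢false (closed-face-visits-all closed u) ¬Vu
      ... | no ¬closed with ¬∀⟶∃¬ n _ (λ y → decO y →-dec decO (α y)) ¬closed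
      ...   | y , ¬imp = no-one-sided (decidable-stable (decO y) (λ ¬oy → ¬imp (λ oy → ⊥-elim (¬oy oy))))
                                      (λ oαy → ¬imp (λ _ → oαy))

  -- Termination measure: live half-edges plus unvisited half-edges.
  unvisited : EdgeSet n → EdgeSet n
  unvisited V z = not (V z)

  μ : State n → ℕ
  μ s = count (State.sub s) + count (unvisited (State.visited s))

  μ-same : ∀ {h h′ S σ₁ σ₂} {V V′ : EdgeSet n} → (∀ z → V′ z ≡ V z) → μ (st h′ S σ₂ V′) ≡ μ (st h S σ₁ V)
  μ-same {S = S} V′≗V = cong (count S +_) (count-ext _ _ (λ z → cong not (V′≗V z)))

  step-shrinks : ∀ {h S σ′ V s′} → Step α F (st h S σ′ V) s′
               → State.sub s′ ⊆B S × unvisited (State.visited s′) ⊆B unvisited V × State.visited s′ h ≡ true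
  step-shrinks {h} {S} {σ′} {V} (delete _ _ _) =
    (λ z e → proj₁ (removeE-elim S h (α h) z e)) , fewer-unvisited , mark-new V h (α h) h (∈e-l h (α h))
    where
      fewer-unvisited : unvisited (mark V h (α h)) ⊆B unvisited V
      fewer-unvisited z e with V z
      ... | false = refl
  step-shrinks {h} {S} {σ′} {V} (keep _ _) =
    (λ z e → e) , fewer-unvisited , mark-new V h (α h) h (∈e-l h (α h))
    where
      fewer-unvisited : unvisited (mark V h (α h)) ⊆B unvisited V
      fewer-unvisited z e with V z
      ... | false = refl

  μ-step : ∀ {h S σ′ V s′} → Step α F (st h S σ′ V) s′ → μ s′ ≤ μ (st h S σ′ V)
  μ-step step with step-shrinks step
  ... | S⊆ , U⊆ , _ = +-mono-≤ (count-mono _ _ S⊆) (count-mono _ _ U⊆)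

  μ-visit : ∀ {h S σ′ V s′} → Step α F (st h S σ′ V) s′ → V h ≡ false → μ s′ < μ (st h S σ′ V)
  μ-visit {s′ = st _ _ _ V′} step ¬Vh with step-shrinks step
  ... | S⊆ , U⊆ , V′h = +-mono-≤-< (count-mono _ _ S⊆) (count-strict _ _ U⊆ _ (cong not V′h) (cong not ¬Vh))

  μ-delete : ∀ {h S σ′ V} (step : Step α F (st h S σ′ V) (st (σ′ (α h)) (removeE S h (α h)) (deleteσ σ′ h (α h)) (mark V h (α h))))
           → S h ≡ true → μ (st (σ′ (α h)) (removeE S h (α h)) (deleteσ σ′ h (α h)) (mark V h (α h))) < μ (st h S σ′ V)
  μ-delete {h} {S} step Sh with step-shrinks step
  ... | S⊆ , U⊆ , _ = +-mono-<-≤ (count-strict _ _ S⊆ h removed Sh) (count-mono _ _ U⊆)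
    where
      removed : removeE S h (α h) h ≡ false
      removed rewrite ∈e-l h (α h) | Sh = refl

  some-step : ∀ h S σ′ V → (∃ λ u → V u ≡ false) → Σ (State n) λ s′ → Step α F (st h S σ′ V) s′
  some-step h S σ′ V unvisited with F h ≟B true
  ... | yes Fh = _ , keep unvisited (inj₂ Fh)
  ... | no ¬Fh with DeletedConnectivity.decIsthmus S σ′ α h
  ...   | yes isthmus = _ , keep unvisited (inj₁ isthmus)
  ...   | no ¬isthmus = _ , delete unvisited ¬isthmus (¬-not ¬Fh)

  -- From a live current half-edge, τ walks along its face through keepable
  -- half-edges (changing nothing but the position) until it meets one that
  -- is unvisited or gets deleted; by the face walk this happens.
  module LiveProgress {x : Fin n} {S V : EdgeSet n} {σ′ : Fin n → Fin n} (I : Invariant x S σ′ V) (Sx : S x ≡ true) (unvisited-u : ∃ λ u → V u ≡ false) where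
    open FaceWalk I Sx

    still-unvisited : ∀ (V′ : EdgeSet n) → (∀ z → V′ z ≡ V z) → ∃ λ u → V′ u ≡ false
    still-unvisited V′ V′≗V = proj₁ unvisited-u , trans (V′≗V _) (proj₂ unvisited-u)

    decKeepable : ∀ y → Dec (Keepable S σ′ V y)
    decKeepable y with V y ≟B true | DeletedConnectivity.decIsthmus S σ′ α y | F y ≟B true
    ... | no ¬Vy | _           | _      = no λ k → ¬Vy (proj₁ k)
    ... | yes Vy | yes isthmus | _      = yes (Vy , inj₁ isthmus)
    ... | yes Vy | no _        | yes Fy = yes (Vy , inj₂ Fy)
    ... | yes Vy | no ¬isthmus | no ¬Fy = no λ { (_ , inj₁ i) → ¬isthmus i ; (_ , inj₂ f) → ¬Fy f }

    keep-run : ∀ t → (∀ t′ → t′ < t → Keepable S σ′ V (iter φ t′ x))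
             → Σ (EdgeSet n) λ V′ → Run α F (st x S σ′ V) (st (iter φ t x) S σ′ V′) × (∀ z → V′ z ≡ V z)
    keep-run zero _ = V , ε , λ _ → refl
    keep-run (suc t) keepable with keep-run t (λ t′ t′<t → keepable t′ (m<n⇒m<1+n t′<t))
    ... | V′ , run , V′≗V with keepable t ≤-refl
    ...   | Vy , why = mark V′ y (α y) , run ◅◅ (keep (still-unvisited V′ V′≗V) why ◅ ε) , unchanged
      where
        y : Fin n
        y = iter φ t x
        unchanged : ∀ z → mark V′ y (α y) z ≡ V z
        unchanged z = bool-ext
          (λ e → [ (λ V′z → trans (sym (V′≗V z)) V′z)
                 , (λ z∈ → [ (λ z≡y → subst (λ w → V w ≡ true) (sym z≡y) Vy)
                           , (λ z≡αy → subst (λ w → V w ≡ true) (sym z≡αy) (trans (Invariant.V-α I y) Vy)) ]′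
                             (∈e-elim z y (α y) z∈)) ]′ (∨-elim (V′ z) e))
          (λ e → mark-old V′ y (α y) z (trans (V′≗V z) e))

    -- at a non-keepable live half-edge y τ either visits y for the first
    -- time or deletes it; both decrease μ
    stop-at : ∀ y V′ → S y ≡ true → (∀ z → V′ z ≡ V z) → ¬ Keepable S σ′ V y
            → ∃ λ s′ → Step α F (st y S σ′ V′) s′ × μ s′ < μ (st y S σ′ V′)
    stop-at y V′ Sy V′≗V ¬keepable with bool-cases (V y)
    ... | inj₂ ¬Vy = proj₁ visit , proj₂ visit , μ-visit (proj₂ visit) (trans (V′≗V y) ¬Vy)
      where
        visit : Σ (State n) λ s′ → Step α F (st y S σ′ V′) s′
        visit = some-step y S σ′ V′ (still-unvisited V′ V′≗V)
    ... | inj₁ Vy = _ , step , μ-delete step Sy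
      where
        ¬Fy : F y ≡ false
        ¬Fy = ¬-not (λ Fy → ¬keepable (Vy , inj₂ Fy))
        step : Step α F (st y S σ′ V′) (st (σ′ (α y)) (removeE S y (α y)) (deleteσ σ′ y (α y)) (mark V′ y (α y)))
        step = delete {h = y} {S} {σ′} {V′} (still-unvisited V′ V′≗V) (λ isthmus → ¬keepable (Vy , inj₁ isthmus)) ¬Fy

    progress : ∃ λ s′ → Run α F (st x S σ′ V) s′ × μ s′ < μ (st x S σ′ V)
    progress with Faces.period x Sx
    ... | d , per with least-below (λ t → ¬ Keepable S σ′ V (iter φ t x)) (λ t → ¬? (decKeepable (iter φ t x))) (suc d)
    ...   | inj₂ none = ⊥-elim (keepable-face-absurd keepable-face unvisited-u)
      where
        keepable-face : ∀ {y} → O y → Keepable S σ′ V y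
        keepable-face (k , refl) = subst (Keepable S σ′ V) (Faces.iter-mod x (suc d) per k)
          (decidable-stable (decKeepable _) (none (k % suc d) (m%n<n k (suc d))))
    ...   | inj₁ (t , _ , ¬keepable , first) with keep-run t (λ t′ t′<t → decidable-stable (decKeepable _) (first t′ t′<t))
    ...     | V′ , run , V′≗V with stop-at (iter φ t x) V′ (iter-preserves Live φ φ-live t x Sx) V′≗V ¬keepable
    ...       | s′ , step , smaller = s′ , run ◅◅ (step ◅ ε) , ≤-trans smaller (≤-reflexive (μ-same {x} {iter φ t x} {S} {σ′} {σ′} {V} {V′} V′≗V))

  -- A deleted current half-edge is deleted once more, a step that does not
  -- change M′ and leads to the live half-edge σ′ (α h).
  module DeadCurrent {h S σ′ V} (I : Invariant h S σ′ V) (¬Sh : S h ≡ false)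
                     (unvisited-u : ∃ λ u → V u ≡ false) (Sc : S (σ′ (α h)) ≡ true) where
    open Invariant I

    step : Step α F (st h S σ′ V) (st (σ′ (α h)) (removeE S h (α h)) (deleteσ σ′ h (α h)) (mark V h (α h)))
    step = delete {h = h} {S} {σ′} {V} unvisited-u (λ isthmus → true≢false (proj₁ isthmus) ¬Sh) (deleted-∉F h ¬Sh)

    Sc₁ : removeE S h (α h) (σ′ (α h)) ≡ true
    Sc₁ = removeE-intro S h (α h) (σ′ (α h)) Sc (¬-not (λ c∈ → true≢false Sc (dead-edge S-α h ¬Sh _ c∈)))

    unvisited₁ : ∃ λ u → mark V h (α h) u ≡ false
    unvisited₁ = proj₁ unvisited-u , mark-false V h (α h) (proj₁ unvisited-u) (proj₂ unvisited-u)
      (¬-not (λ u∈ → true≢false (deleted-visited _ (dead-edge S-α h ¬Sh _ u∈)) (proj₂ unvisited-u)))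

    progress : ∃ λ s′ → Run α F (st h S σ′ V) s′ × μ s′ < μ (st h S σ′ V)
    progress with LiveProgress.progress (step-preserves I step) Sc₁ unvisited₁
    ... | s′ , run , smaller = s′ , step ◅ run , ≤-trans smaller (μ-step step)

  progress : ∀ s → Inv s → (∃ λ u → State.visited s u ≡ false) → ∃ λ s′ → Run α F s s′ × μ s′ < μ s
  progress (st h S σ′ V) I unvisited-u with bool-cases (S h)
  ... | inj₁ Sh = LiveProgress.progress I Sh unvisited-u
  ... | inj₂ ¬Sh with Invariant.current-ok I ¬Sh
  ...   | inj₁ Sc          = DeadCurrent.progress I ¬Sh unvisited-u Sc
  ...   | inj₂ all-visited = ⊥-elim (true≢false (all-visited (proj₁ unvisited-u)) (proj₂ unvisited-u))

  spanning-tree : ∀ s → Inv s → AllVisited s → SpanningTree σ α (State.sub s)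
  spanning-tree (st h S σ′ V) = final-tree

  terminates : ∀ k s → μ s < k → Inv s → ∃ λ s′ → Run α F s s′ × AllVisited s′ × Inv s′
  terminates (suc k) s μs≤k I with all? (λ z → State.visited s z ≟B true)
  ... | yes all-visited = s , ε , all-visited , I
  ... | no ¬all-visited with ¬∀⟶∃¬ n _ (λ z → State.visited s z ≟B true) ¬all-visited
  ...   | u , ¬Vu with progress s I (u , ¬-not ¬Vu)
  ...     | s′ , run , smaller with terminates k s′ (≤-trans smaller (≤-pred μs≤k)) (run-preserves I run)
  ...       | s″ , run′ , all-visited , I″ = s″ , run ◅◅ run′ , all-visited , I″

proposition3p2 : ∀ (n : ℕ) (σ : Permutation′ n) (α : Fin n → Fin n) (root : Fin n)
    → IsMap σ α
    → (F : EdgeSet n) → SpanningForest σ α F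
    → ∃ λ (s : State n) → Run α F (initState σ root) s × AllVisited s
        × SpanningTree σ α (State.sub s)
proposition3p2 n σ α root isMap F forest =
  let open Procedure σ α F isMap forest
      start = initState σ root
      (s , run , all-visited , I) = terminates (suc (μ start)) start ≤-refl (initial root)
  in s , run , all-visited , spanning-tree s I all-visited
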